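{- For $q > q_0(\ell) := \frac{2^{\frac{1}{\ell-1}}}{2^{\frac{1}{\ell-1}}-1}$, we have $$q^{\alpha_{k+1}-\alpha_k-1}\Big(|\Omega_{\alpha}(\ell, V_m, \mathcal{B})| - q^{\ell-k}\,|\Omega_{\alpha'}(\ell, V_{m-1}, \mathcal{B}')|\Big) > q^{\delta(\alpha')} + q^{m-\ell}\,|\Omega_{\check{\alpha}}(\ell-1, V_{m-1}, \mathcal{B}')| - q^{\delta(\alpha)}.$$
   Context: Let $\mathbb{F}_q$ be a finite field, $2 \le \ell \le m-1$, and let $V_m$ be an $m$-dimensional vector space over $\mathbb{F}_q$ with ordered basis $\mathcal{B}=\{v_1,\dots,v_m\}$; write $V_i=\mathrm{span}\{v_1,\dots,v_i\}$ and $\mathcal{B}'=\{v_1,\dots,v_{m-1}\}$ (a basis of $V_{m-1}$). Let $I(\ell,m)=\{(\alpha_1,\dots,\alpha_\ell)\in\mathbb{Z}^\ell : 1\le\alpha_1<\dots<\alpha_\ell\le m\}$ and for $\alpha\in I(\ell,m)$ the Schubert variety $\Omega_\alpha(\ell,V_m,\mathcal{B})=\{L \subseteq V_m,\ \dim L=\ell : \dim(L\cap V_{\alpha_i})\ge i \text{ for all } i\}$, with $\delta(\alpha)=\alpha_1+\dots+\alpha_\ell-\frac{\ell(\ell+1)}{2}$. Fix $\alpha\in I(\ell,m)$ with $\alpha_\ell=m$ and $\alpha_1,\dots,\alpha_\ell$ not all consecutive integers. Let $k=\max\{j:\alpha_{j+1}-\alpha_j\ge 2\}$ (so $1\le k\le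 \ell-1$), $\alpha'=(\alpha_1,\dots,\alpha_k,\alpha_{k+1}-1,\dots,\alpha_\ell-1)$, and $\check{\alpha}=(\alpha_1,\dots,\alpha_{\ell-1})$. Then $\Omega_{\alpha'}(\ell,V_{m-1},\mathcal{B}')$ and $\Omega_{\check{\alpha}}(\ell-1,V_{m-1},\mathcal{B}')$ are the analogous Schubert varieties in $V_{m-1}$ with respect to $\mathcal{B}'$. -}

module Defs where

open import Level using (0ℓ) renaming (suc to lsuc)
open import Algebra.Bundles using (CommutativeRing)
open import Data.Nat as ℕ using (ℕ; zero; suc)
open import Data.Nat.Properties using (m∸n≤m)
open import Data.Fin as Fin using (Fin; toℕ; inject≤)
open import Data.Product using (Σ; ∃; _×_; _,_)
open import Relation.Nullary using (¬_)
open import Relation.Binary.Bundles using (Setoid)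
open import Relation.Binary.PropositionalEquality as ≡ using (_≡_)
open import Function.Bundles using (Bijection)

record FiniteField (q : ℕ) : Set₁ where
  field
    commRing : CommutativeRing 0ℓ 0ℓ
  open CommutativeRing commRing public hiding (ring)
  field
    1≉0         : ¬ (1# ≈ 0#)
    inverse     : ∀ x → ¬ (x ≈ 0#) → ∃ λ y → (x * y) ≈ 1#
    enumeration : Bijection (≡.setoid (Fin q)) setoid

HasCard : ∀ {c e} → Setoid c e → ℕ → Set (c Level.⊔ e)
HasCard S N = Bijection (≡.setoid (Fin N)) S

-- Linear algebra in the coordinate space F^n = V_n, with standard
-- ordered basis e_1, …, e_n (coordinate j : Fin n is e_{toℕ j + 1}).

module LinearAlgebra {q : ℕ} (F : FiniteField q) where
  open FiniteField F

  Vect : ℕ → Set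
  Vect n = Fin n → Carrier

  _≋_ : ∀ {n} → Vect n → Vect n → Set
  u ≋ v = ∀ j → u j ≈ v j

  0v : ∀ {n} → Vect n
  0v _ = 0#

  _+v_ : ∀ {n} → Vect n → Vect n → Vect n
  (u +v v) j = u j + v j

  _·v_ : ∀ {n} → Carrier → Vect n → Vect n
  (a ·v v) j = a * v j

  lincomb : ∀ {n k} → (Fin k → Carrier) → (Fin k → Vect n) → Vect n
  lincomb {k = zero}  c b = 0v
  lincomb {k = suc k} c b = (c Fin.zero ·v b Fin.zero) +v lincomb (λ i → c (Fin.suc i)) (λ i → b (Fin.suc i))

  LinIndep : ∀ {n k} → (Fin k → Vect n) → Set
  LinIndep b = ∀ c → lincomb c b ≋ 0v → ∀ i → c i ≈ 0#

  record Subspace (n : ℕ) : Set₁ where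
    field
      member : Vect n → Set
      resp   : ∀ {u v} → u ≋ v → member u → member v
      0∈     : member 0v
      +∈     : ∀ {u v} → member u → member v → member (u +v v)
      ·∈     : ∀ a {v} → member v → member (a ·v v)
  open Subspace public

  HasDim : ∀ {n} → Subspace n → ℕ → Set
  HasDim {n} L d =
    Σ (Fin d → Vect n) λ b →
      LinIndep b × (∀ i → member L (b i)) ×
      (∀ v → member L v → ∃ λ c → v ≋ lincomb c b)

  -- v ∈ V_i = span{e_1, …, e_i}: all coordinates beyond the i-th vanish
  InStd : ∀ {n} → ℕ → Vect n → Set
  InStd i v = ∀ j → i ℕ.≤ toℕ j → v j ≈ 0#

  DimCapAtLeast : ∀ {n} → Subspace n → ℕ → ℕ → Set
  DimCapAtLeast {n} L i d =
    Σ (Fin d → Vect n) λ b →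
      LinIndep b × (∀ j → member L (b j) × InStd i (b j))

  record SchubertPoint (ℓ n : ℕ) (α : Fin ℓ → ℕ) : Set₁ where
    field
      L    : Subspace n
      dimL : HasDim L ℓ
      cond : ∀ (i : Fin ℓ) → DimCapAtLeast L (α i) (suc (toℕ i))

  Schubert : (ℓ n : ℕ) → (Fin ℓ → ℕ) → Setoid (lsuc 0ℓ) 0ℓ
  Schubert ℓ n α = record
    { Carrier = SchubertPoint ℓ n α
    ; _≈_ = λ P Q → ∀ v → (member (SchubertPoint.L P) v → member (SchubertPoint.L Q) v)
                         × (member (SchubertPoint.L Q) v → member (SchubertPoint.L P) v)
    ; isEquivalence = record
      { refl  = λ v → (λ x → x) , (λ x → x)
      ; sym   = λ e v → let (f , g) = e v in g , f
      ; trans = λ e₁ e₂ v → let (f₁ , g₁) = e₁ v ; (f₂ , g₂) = e₂ v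
                            in (λ x → f₂ (f₁ x)) , (λ x → g₁ (g₂ x))
      }
    }

-- Index sequences α = (α_1, …, α_ℓ), stored 0-based as Fin ℓ → ℕ
-- (α_i in the paper is α (i-1) here).

-- 1-based access: α ! i = α_i for 1 ≤ i ≤ ℓ (and 0 otherwise)
_!_ : ∀ {ℓ} → (Fin ℓ → ℕ) → ℕ → ℕ
_!_ {zero}  α i             = 0
_!_ {suc ℓ} α zero          = 0
_!_ {suc ℓ} α (suc zero)    = α Fin.zero
_!_ {suc ℓ} α (suc (suc i)) = (λ j → α (Fin.suc j)) ! suc i

InI : (ℓ m : ℕ) → (Fin ℓ → ℕ) → Set
InI ℓ m α = (∀ i → 1 ℕ.≤ α i) × (∀ i → α i ℕ.≤ m) × (∀ i j → i Fin.< j → α i ℕ.< α j)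

IsMaxGap : ∀ {ℓ} → (Fin ℓ → ℕ) → ℕ → Set
IsMaxGap {ℓ} α k =
  1 ℕ.≤ k × k ℕ.≤ ℓ ℕ.∸ 1 × 2 ℕ.+ (α ! k) ℕ.≤ α ! suc k ×
  (∀ j → k ℕ.< j → j ℕ.≤ ℓ ℕ.∸ 1 → ¬ (2 ℕ.+ (α ! j) ℕ.≤ α ! suc j))

αprime : ∀ {ℓ} → ℕ → (Fin ℓ → ℕ) → Fin ℓ → ℕ
αprime k α j with suc (toℕ j) ℕ.≤? k
... | Relation.Nullary.yes _ = α j
... | Relation.Nullary.no  _ = α j ℕ.∸ 1

αcheck : ∀ {ℓ} → (Fin ℓ → ℕ) → Fin (ℓ ℕ.∸ 1) → ℕ
αcheck {ℓ} α j = α (inject≤ j (m∸n≤m ℓ 1))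

tri : ℕ → ℕ
tri zero    = 0
tri (suc n) = suc n ℕ.+ tri n

sumF : ∀ {ℓ} → (Fin ℓ → ℕ) → ℕ
sumF {zero}  α = 0
sumF {suc ℓ} α = α Fin.zero ℕ.+ sumF (λ j → α (Fin.suc j))

δ : ∀ {ℓ} → (Fin ℓ → ℕ) → ℕ
δ {ℓ} α = sumF α ℕ.∸ tri ℓ

module Submission where

-- The points of Ω_α(ℓ, V_n) are in bijection with reduced column echelon bases, so their number #Ω q ℓ n α obeys
-- #Ω (ℓ+1) (n+1) = #Ω (ℓ+1) n + [n+1 ≤ α_{ℓ+1}] q^(n-ℓ) #Ω ℓ n. Peeling off the last coordinate of V_m gives
-- |Ω_α| = #Ω ℓ (m-1) α + q^(m-ℓ) |Ω_α̌|; in V_{m-1} the conditions of the final consecutive block of α (and of α′)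
-- are vacuous, so both remaining counts arise from the count h of the first k conditions by adding s + 1 = ℓ - k
-- unconstrained vectors. Writing h = A·[N ≥ d] + ε with ε supported below d, the terms in A cancel exactly by the
-- q-Pascal identity, and what is left is q^g Y < q^δ(α′) for the contribution Y of ε. The crude bound
-- (q-1)^L |Ω| ≤ q^(L+δ) proves this as soon as q^(ℓ-1) < 2 (q-1)^(ℓ-1), which is q > q₀(ℓ).

open import Data.Nat as ℕ using (ℕ; zero; suc)
open import Data.Nat.Properties using (m≤n⇒m≤1+n; <-irrefl; <-≤-trans; ≤-trans; <⇒≤; ≰⇒>; ≤-pred)
open import Data.Fin as Fin using (Fin; zero; suc; toℕ; inject₁; inject≤; fromℕ; fromℕ<; punchIn; cast; remQuot; combine; splitAt; join)
open import Data.Fin.Properties using (toℕ-inject₁; toℕ-fromℕ; toℕ<n; all?; ¬∀⟶∃¬; punchIn-punchOut; toℕ-cast; toℕ-injective;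
  cast-involutive; combine-remQuot; remQuot-combine; splitAt-join; join-splitAt; cantor-schröder-bernstein; toℕ-fromℕ<; toℕ-inject≤)
open import Data.Vec.Functional using (_∷_; init; insertAt)
open import Data.Vec.Functional.Properties using (insertAt-punchIn; insertAt-lookup)
open import Data.Product using (Σ; ∃; _×_; _,_; proj₁; proj₂; uncurry)
open import Data.Sum using (_⊎_; inj₁; inj₂)
open import Data.Unit using (⊤; tt)
open import Data.Empty using (⊥; ⊥-elim)
open import Function using (_∘_; id)
open import Function.Bundles using (Bijection)
open import Function.Definitions using (Injective)
open import Relation.Binary.Bundles using (Setoid)
open import Relation.Nullary using (¬_; Dec; yes; no)
open import Relation.Binary.PropositionalEquality as ≡ using (_≡_)
open import Algebra.Bundles using (CommutativeRing)
open import Defs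

snoc : ∀ {a} {A : Set a} {n} → (Fin n → A) → A → Fin (suc n) → A
snoc {n = zero}  v x zero    = x
snoc {n = suc n} v x zero    = v zero
snoc {n = suc n} v x (suc j) = snoc (v ∘ suc) x j

snoc-inject₁ : ∀ {a} {A : Set a} {n} (v : Fin n → A) x j → snoc v x (inject₁ j) ≡ v j
snoc-inject₁ {n = suc n} v x zero    = ≡.refl
snoc-inject₁ {n = suc n} v x (suc j) = snoc-inject₁ (v ∘ suc) x j

snoc-fromℕ : ∀ {a} {A : Set a} {n} (v : Fin n → A) x → snoc v x (fromℕ n) ≡ x
snoc-fromℕ {n = zero}  v x = ≡.refl
snoc-fromℕ {n = suc n} v x = snoc-fromℕ (v ∘ suc) x

snoc-inject₁⁻ : ∀ {n} (P : Fin n → Set) (X : Set) {j} → snoc P X (inject₁ j) → P j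
snoc-inject₁⁻ P X {j} = ≡.subst id (snoc-inject₁ P X j)

snoc-inject₁⁺ : ∀ {n} (P : Fin n → Set) (X : Set) {j} → P j → snoc P X (inject₁ j)
snoc-inject₁⁺ P X {j} = ≡.subst id (≡.sym (snoc-inject₁ P X j))

snoc-fromℕ⁻ : ∀ {n} (P : Fin n → Set) (X : Set) → snoc P X (fromℕ n) → X
snoc-fromℕ⁻ P X = ≡.subst id (snoc-fromℕ P X)

snoc-fromℕ⁺ : ∀ {n} (P : Fin n → Set) (X : Set) → X → snoc P X (fromℕ n)
snoc-fromℕ⁺ P X = ≡.subst id (≡.sym (snoc-fromℕ P X))

∀-inject₁-fromℕ : ∀ {p n} {P : Fin (suc n) → Set p} → (∀ j → P (inject₁ j)) → P (fromℕ n) → ∀ j → P j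
∀-inject₁-fromℕ {n = zero}  f x zero    = x
∀-inject₁-fromℕ {n = suc n} f x zero    = f zero
∀-inject₁-fromℕ {n = suc n} {P} f x (suc j) = ∀-inject₁-fromℕ {P = P ∘ suc} (f ∘ suc) x j

remQuot-injective : ∀ {n} k {z z′ : Fin (n ℕ.* k)} → remQuot k z ≡ remQuot k z′ → z ≡ z′
remQuot-injective {n} k {z} {z′} eq =
  ≡.trans (≡.sym (combine-remQuot {n} k z)) (≡.trans (≡.cong (uncurry (combine {n} {k})) eq) (combine-remQuot {n} k z′))

cast-injective : ∀ {m n} .(eq : m ≡ n) {z z′ : Fin m} → cast eq z ≡ cast eq z′ → z ≡ z′
cast-injective eq {z} {z′} h = toℕ-injective (≡.trans (≡.sym (toℕ-cast eq z)) (≡.trans (≡.cong toℕ h) (toℕ-cast eq z′)))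

∸-suc : ∀ {m n} → suc m ℕ.≤ n → n ℕ.∸ m ≡ suc (n ℕ.∸ suc m)
∸-suc {zero}  (ℕ.s≤s _)   = ≡.refl
∸-suc {suc m} (ℕ.s≤s m<n) = ∸-suc m<n

hasCard-unique : ∀ {c e} {S : Setoid c e} {m n} → HasCard S m → HasCard S n → m ≡ n
hasCard-unique {S = S} f g = cantor-schröder-bernstein (through-injective f g) (through-injective g f)
  where
  module S = Setoid S
  through : ∀ {m n} → HasCard S m → HasCard S n → Fin m → Fin n
  through f g x = proj₁ (Bijection.surjective g (Bijection.to f x))
  through-≈ : ∀ {m n} (f : HasCard S m) (g : HasCard S n) x → Bijection.to g (through f g x) S.≈ Bijection.to f x
  through-≈ f g x = proj₂ (Bijection.surjective g (Bijection.to f x)) ≡.refl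
  through-injective : ∀ {m n} (f : HasCard S m) (g : HasCard S n) → Injective _≡_ _≡_ (through f g)
  through-injective f g {x} {y} eq = Bijection.injective f
    (S.trans (S.sym (through-≈ f g x)) (S.trans (S.reflexive (≡.cong (Bijection.to g) eq)) (through-≈ f g y)))

-- Linear algebra over F

module LinearCombinations {q : ℕ} (F : FiniteField q) where

  open FiniteField F hiding (zero)
  open LinearAlgebra F public
  open import Relation.Binary.Reasoning.Setoid setoid
  open import Algebra.Properties.CommutativeSemigroup +-commutativeSemigroup using (interchange; x∙yz≈y∙xz)

  dot : ∀ {k} → (Fin k → Carrier) → (Fin k → Carrier) → Carrier
  dot {zero}  c x = 0#
  dot {suc k} c x = c zero * x zero + dot (c ∘ suc) (x ∘ suc)

  dot-cong : ∀ {k} {c d x y : Fin k → Carrier} → (∀ i → c i ≈ d i) → (∀ i → x i ≈ y i) → dot c x ≈ dot d y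
  dot-cong {zero}  c≈d x≈y = refl
  dot-cong {suc k} c≈d x≈y = +-cong (*-cong (c≈d zero) (x≈y zero)) (dot-cong (c≈d ∘ suc) (x≈y ∘ suc))

  dot-zeroʳ : ∀ {k} (c x : Fin k → Carrier) → (∀ i → x i ≈ 0#) → dot c x ≈ 0#
  dot-zeroʳ {zero}  c x x≈0 = refl
  dot-zeroʳ {suc k} c x x≈0 = begin
    c zero * x zero + dot (c ∘ suc) (x ∘ suc) ≈⟨ +-cong (trans (*-congˡ (x≈0 zero)) (zeroʳ _)) (dot-zeroʳ (c ∘ suc) (x ∘ suc) (x≈0 ∘ suc)) ⟩
    0# + 0#                                   ≈⟨ +-identityʳ 0# ⟩
    0#                                        ∎

  dot-distribʳ-+ : ∀ {k} (c x y : Fin k → Carrier) → dot c (λ j → x j + y j) ≈ dot c x + dot c y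
  dot-distribʳ-+ {zero}  c x y = sym (+-identityʳ 0#)
  dot-distribʳ-+ {suc k} c x y =
    trans (+-cong (distribˡ _ _ _) (dot-distribʳ-+ (c ∘ suc) (x ∘ suc) (y ∘ suc))) (interchange _ _ _ _)

  dot-*ʳ : ∀ {k} (c x : Fin k → Carrier) z → dot c (λ j → x j * z) ≈ dot c x * z
  dot-*ʳ {zero}  c x z = sym (zeroˡ z)
  dot-*ʳ {suc k} c x z =
    trans (+-cong (sym (*-assoc _ _ _)) (dot-*ʳ (c ∘ suc) (x ∘ suc) z)) (sym (distribʳ z _ _))

  lincomb-coord : ∀ {n k} (c : Fin k → Carrier) (b : Fin k → Vect n) j → lincomb c b j ≡ dot c (λ i → b i j)
  lincomb-coord {k = zero}  c b j = ≡.refl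
  lincomb-coord {k = suc k} c b j = ≡.cong (c zero * b zero j +_) (lincomb-coord (c ∘ suc) (b ∘ suc) j)

  lincomb-coord-zero : ∀ {n k} (c : Fin k → Carrier) (b : Fin k → Vect n) j → (∀ i → b i j ≈ 0#) → lincomb c b j ≈ 0#
  lincomb-coord-zero c b j b≈0 = trans (reflexive (lincomb-coord c b j)) (dot-zeroʳ c _ b≈0)

  lincomb-cong : ∀ {n k} {c d : Fin k → Carrier} (b : Fin k → Vect n) → (∀ i → c i ≈ d i) → lincomb c b ≋ lincomb d b
  lincomb-cong {k = zero}  b c≈d j = refl
  lincomb-cong {k = suc k} b c≈d j = +-cong (*-congʳ (c≈d zero)) (lincomb-cong (b ∘ suc) (c≈d ∘ suc) j)

  lincomb-congʳ : ∀ {n k} (c : Fin k → Carrier) {b b′ : Fin k → Vect n} → (∀ i → b i ≋ b′ i) → lincomb c b ≋ lincomb c b′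
  lincomb-congʳ {k = zero}  c b≋b′ j = refl
  lincomb-congʳ {k = suc k} c b≋b′ j = +-cong (*-congˡ (b≋b′ zero j)) (lincomb-congʳ (c ∘ suc) (b≋b′ ∘ suc) j)

  lincomb-zero : ∀ {n k} (b : Fin k → Vect n) → lincomb (λ _ → 0#) b ≋ 0v
  lincomb-zero {k = zero}  b j = refl
  lincomb-zero {k = suc k} b j = trans (+-cong (zeroˡ _) (lincomb-zero (b ∘ suc) j)) (+-identityʳ 0#)

  lincomb-+ : ∀ {n k} (c d : Fin k → Carrier) (b : Fin k → Vect n) → lincomb (λ i → c i + d i) b ≋ (lincomb c b +v lincomb d b)
  lincomb-+ {k = zero}  c d b j = sym (+-identityʳ 0#)
  lincomb-+ {k = suc k} c d b j =
    trans (+-cong (distribʳ _ _ _) (lincomb-+ (c ∘ suc) (d ∘ suc) (b ∘ suc) j)) (interchange _ _ _ _)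

  lincomb-* : ∀ {n k} a (c : Fin k → Carrier) (b : Fin k → Vect n) → lincomb (λ i → a * c i) b ≋ (a ·v lincomb c b)
  lincomb-* {k = zero}  a c b j = sym (zeroʳ a)
  lincomb-* {k = suc k} a c b j =
    trans (+-cong (*-assoc _ _ _) (lincomb-* a (c ∘ suc) (b ∘ suc) j)) (sym (distribˡ a _ _))

  lincomb-lincomb : ∀ {n k m} (a : Fin m → Carrier) (c : Fin m → Vect k) (v : Fin k → Vect n) →
                    lincomb (lincomb a c) v ≋ lincomb a (λ i → lincomb (c i) v)
  lincomb-lincomb {m = zero}  a c v j = lincomb-zero v j
  lincomb-lincomb {m = suc m} a c v j = begin
    lincomb (lincomb a c) v j
      ≈⟨ lincomb-+ _ _ v j ⟩
    lincomb (λ i → a zero * c zero i) v j + lincomb (lincomb (a ∘ suc) (c ∘ suc)) v j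
      ≈⟨ +-cong (lincomb-* (a zero) (c zero) v j) (lincomb-lincomb (a ∘ suc) (c ∘ suc) v j) ⟩
    lincomb a (λ i → lincomb (c i) v) j ∎

  lincomb-punchIn : ∀ {n k} (c : Fin (suc k) → Carrier) (b : Fin (suc k) → Vect n) p →
                    lincomb c b ≋ ((c p ·v b p) +v lincomb (c ∘ punchIn p) (b ∘ punchIn p))
  lincomb-punchIn c b zero j = refl
  lincomb-punchIn {k = suc k} c b (suc p) j = begin
    c zero * b zero j + lincomb (c ∘ suc) (b ∘ suc) j
      ≈⟨ +-congˡ (lincomb-punchIn (c ∘ suc) (b ∘ suc) p j) ⟩
    c zero * b zero j + (c (suc p) * b (suc p) j + rest)
      ≈⟨ x∙yz≈y∙xz _ _ _ ⟩
    c (suc p) * b (suc p) j + (c zero * b zero j + rest) ∎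
    where
    rest = lincomb (c ∘ suc ∘ punchIn p) (b ∘ suc ∘ punchIn p) j

  unitVector : ∀ {k} → Fin k → Fin k → Carrier
  unitVector zero    zero    = 1#
  unitVector zero    (suc j) = 0#
  unitVector (suc i) zero    = 0#
  unitVector (suc i) (suc j) = unitVector i j

  lincomb-unitVector : ∀ {n k} (i : Fin k) (b : Fin k → Vect n) → lincomb (unitVector i) b ≋ b i
  lincomb-unitVector zero    b j = trans (+-cong (*-identityˡ _) (lincomb-zero (b ∘ suc) j)) (+-identityʳ _)
  lincomb-unitVector (suc i) b j = trans (+-cong (zeroˡ _) (lincomb-unitVector i (b ∘ suc) j)) (+-identityˡ _)

  InSpan : ∀ {n k} → (Fin k → Vect n) → Vect n → Set
  InSpan b v = ∃ λ c → v ≋ lincomb c b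

  span : ∀ {n k} → (Fin k → Vect n) → Subspace n
  span b = record
    { member = InSpan b
    ; resp   = λ { u≋v (c , u≋bc) → c , (λ j → trans (sym (u≋v j)) (u≋bc j)) }
    ; 0∈     = (λ _ → 0#) , (λ j → sym (lincomb-zero b j))
    ; +∈     = λ { (c , u≋) (d , v≋) → (λ i → c i + d i) , (λ j → trans (+-cong (u≋ j) (v≋ j)) (sym (lincomb-+ c d b j))) }
    ; ·∈     = λ { a (c , v≋) → (λ i → a * c i) , (λ j → trans (*-congˡ (v≋ j)) (sym (lincomb-* a c b j))) }
    }

  member-lincomb : ∀ {n k} (L : Subspace n) (c : Fin k → Carrier) (b : Fin k → Vect n) →
                   (∀ i → member L (b i)) → member L (lincomb c b)
  member-lincomb {k = zero}  L c b b∈L = 0∈ L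
  member-lincomb {k = suc k} L c b b∈L =
    +∈ L (·∈ L (c zero) (b∈L zero)) (member-lincomb L (c ∘ suc) (b ∘ suc) (b∈L ∘ suc))

  ∈-span : ∀ {n k} (b : Fin k → Vect n) i → InSpan b (b i)
  ∈-span b i = unitVector i , (λ j → sym (lincomb-unitVector i b j))

  InSpan⇒member : ∀ {n k} (L : Subspace n) {b : Fin k → Vect n} → (∀ i → member L (b i)) → ∀ {v} → InSpan b v → member L v
  InSpan⇒member L {b} b∈L (c , v≋) = resp L (λ j → sym (v≋ j)) (member-lincomb L c b b∈L)

  span-⊆ : ∀ {n k k′} {b : Fin k → Vect n} {b′ : Fin k′ → Vect n} → (∀ i → InSpan b′ (b i)) → ∀ {v} → InSpan b v → InSpan b′ v
  span-⊆ {b′ = b′} = InSpan⇒member (span b′)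

  padZeros : ∀ {m ℓ} → m ℕ.≤ ℓ → (Fin m → Carrier) → Fin ℓ → Carrier
  padZeros ℕ.z≤n      a = λ _ → 0#
  padZeros (ℕ.s≤s le) a = a zero ∷ padZeros le (a ∘ suc)

  padZeros-inject≤ : ∀ {m ℓ} (le : m ℕ.≤ ℓ) a j → padZeros le a (inject≤ j le) ≡ a j
  padZeros-inject≤ (ℕ.s≤s le) a zero    = ≡.refl
  padZeros-inject≤ (ℕ.s≤s le) a (suc j) = padZeros-inject≤ le (a ∘ suc) j

  lincomb-padZeros : ∀ {n m ℓ} (le : m ℕ.≤ ℓ) a (b : Fin ℓ → Vect n) → lincomb (padZeros le a) b ≋ lincomb a (λ j → b (inject≤ j le))
  lincomb-padZeros ℕ.z≤n      a b   = lincomb-zero b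
  lincomb-padZeros (ℕ.s≤s le) a b j = +-congˡ (lincomb-padZeros le (a ∘ suc) (b ∘ suc) j)

  linIndep-prefix : ∀ {n m ℓ} (le : m ℕ.≤ ℓ) {b : Fin ℓ → Vect n} → LinIndep b → LinIndep (λ j → b (inject≤ j le))
  linIndep-prefix le {b} indep a a·b≈0 j = trans (reflexive (≡.sym (padZeros-inject≤ le a j)))
    (indep (padZeros le a) (λ t → trans (lincomb-padZeros le a b t) (a·b≈0 t)) (inject≤ j le))

  InSpan-cong : ∀ {n k} {b b′ : Fin k → Vect n} → (∀ i → b i ≋ b′ i) → ∀ {v} → InSpan b v → InSpan b′ v
  InSpan-cong b≋b′ (a , v≋) = a , (λ j → trans (v≋ j) (lincomb-congʳ a b≋b′ j))

module LastCoordinate {q : ℕ} (F : FiniteField q) where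

  open FiniteField F hiding (zero)
  open LinearCombinations F public
  open import Relation.Binary.Reasoning.Setoid setoid

  lift : ∀ {n} → Vect n → Vect (suc n)
  lift v = snoc v 0#

  snoc-cong : ∀ {n} {u v : Vect n} {x y} → u ≋ v → x ≈ y → snoc u x ≋ snoc v y
  snoc-cong {u = u} {v} {x} {y} u≋v x≈y = ∀-inject₁-fromℕ
    (λ j → trans (reflexive (snoc-inject₁ u x j)) (trans (u≋v j) (reflexive (≡.sym (snoc-inject₁ v y j)))))
    (trans (reflexive (snoc-fromℕ u x)) (trans x≈y (reflexive (≡.sym (snoc-fromℕ v y)))))

  snoc-injective : ∀ {n} {u v : Vect n} {x y} → snoc u x ≋ snoc v y → u ≋ v × x ≈ y
  snoc-injective {n} {u} {v} {x} {y} eq =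
    (λ j → trans (reflexive (≡.sym (snoc-inject₁ u x j))) (trans (eq (inject₁ j)) (reflexive (snoc-inject₁ v y j)))) ,
    trans (reflexive (≡.sym (snoc-fromℕ u x))) (trans (eq (fromℕ n)) (reflexive (snoc-fromℕ v y)))

  snoc-init : ∀ {n} (v : Vect (suc n)) → snoc (init v) (v (fromℕ n)) ≋ v
  snoc-init v = ∀-inject₁-fromℕ (λ j → reflexive (snoc-inject₁ (init v) _ j)) (reflexive (snoc-fromℕ (init v) _))

  lift-init : ∀ {n} (v : Vect (suc n)) → v (fromℕ n) ≈ 0# → lift (init v) ≋ v
  lift-init v v≈0 j = trans (snoc-cong (λ _ → refl) (sym v≈0) j) (snoc-init v j)

  lincomb-snoc-inject₁ : ∀ {n k} (a : Fin k → Carrier) (b : Fin k → Vect n) (x : Fin k → Carrier) j →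
                         lincomb a (λ i → snoc (b i) (x i)) (inject₁ j) ≈ lincomb a b j
  lincomb-snoc-inject₁ a b x j = begin
    lincomb a (λ i → snoc (b i) (x i)) (inject₁ j) ≡⟨ lincomb-coord a _ (inject₁ j) ⟩
    dot a (λ i → snoc (b i) (x i) (inject₁ j))     ≈⟨ dot-cong (λ _ → refl) (λ i → reflexive (snoc-inject₁ (b i) (x i) j)) ⟩
    dot a (λ i → b i j)                             ≡⟨ lincomb-coord a b j ⟨
    lincomb a b j                                   ∎

  lincomb-snoc-fromℕ : ∀ {n k} (a : Fin k → Carrier) (b : Fin k → Vect n) (x : Fin k → Carrier) →
                       lincomb a (λ i → snoc (b i) (x i)) (fromℕ n) ≈ dot a x
  lincomb-snoc-fromℕ {n} a b x = begin
    lincomb a (λ i → snoc (b i) (x i)) (fromℕ n) ≡⟨ lincomb-coord a _ (fromℕ n) ⟩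
    dot a (λ i → snoc (b i) (x i) (fromℕ n))     ≈⟨ dot-cong (λ _ → refl) (λ i → reflexive (snoc-fromℕ (b i) (x i))) ⟩
    dot a x                                       ∎

  lincomb-lift-inject₁ : ∀ {n k} (a : Fin k → Carrier) (b : Fin k → Vect n) j → lincomb a (lift ∘ b) (inject₁ j) ≈ lincomb a b j
  lincomb-lift-inject₁ a b = lincomb-snoc-inject₁ a b (λ _ → 0#)

  lincomb-lift-fromℕ : ∀ {n k} (a : Fin k → Carrier) (b : Fin k → Vect n) → lincomb a (lift ∘ b) (fromℕ n) ≈ 0#
  lincomb-lift-fromℕ a b = trans (lincomb-snoc-fromℕ a b _) (dot-zeroʳ a _ (λ _ → refl))

  lift-lincomb : ∀ {n k} (a : Fin k → Carrier) (b : Fin k → Vect n) → lift (lincomb a b) ≋ lincomb a (lift ∘ b)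
  lift-lincomb a b = ∀-inject₁-fromℕ
    (λ j → trans (reflexive (snoc-inject₁ (lincomb a b) 0# j)) (sym (lincomb-lift-inject₁ a b j)))
    (trans (reflexive (snoc-fromℕ (lincomb a b) 0#)) (sym (lincomb-lift-fromℕ a b)))

  lincomb-init : ∀ {n k} (c : Fin k → Carrier) (b : Fin k → Vect (suc n)) j → lincomb c b (inject₁ j) ≈ lincomb c (init ∘ b) j
  lincomb-init c b j = reflexive (≡.trans (lincomb-coord c b (inject₁ j)) (≡.sym (lincomb-coord c (init ∘ b) j)))

  lift-InSpan : ∀ {n k} {b : Fin k → Vect n} {v} → InSpan b v → InSpan (lift ∘ b) (lift v)
  lift-InSpan {b = b} (a , v≋) = a , (λ j → trans (snoc-cong v≋ refl j) (lift-lincomb a b j))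

  lift-InSpan⁻ : ∀ {n k} {b : Fin k → Vect n} {v} → InSpan (lift ∘ b) (lift v) → InSpan b v
  lift-InSpan⁻ {b = b} {v} (a , v≋) =
    a , (λ j → trans (reflexive (≡.sym (snoc-inject₁ v 0# j))) (trans (v≋ (inject₁ j)) (lincomb-lift-inject₁ a b j)))

  init-InSpan : ∀ {n k} {b : Fin k → Vect (suc n)} {v} → InSpan b v → InSpan (init ∘ b) (init v)
  init-InSpan {b = b} (c , v≋) = c , (λ j → trans (v≋ (inject₁ j)) (lincomb-init c b j))

  lift-linIndep : ∀ {n k} {b : Fin k → Vect n} → LinIndep b → LinIndep (lift ∘ b)
  lift-linIndep {b = b} indep a ab≈0 = indep a (λ j → trans (sym (lincomb-lift-inject₁ a b j)) (ab≈0 (inject₁ j)))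

  init-linIndep : ∀ {n k} {b : Fin k → Vect (suc n)} → (∀ i → b i (fromℕ n) ≈ 0#) → LinIndep b → LinIndep (init ∘ b)
  init-linIndep {n} {b = b} last≈0 indep a ab≈0 =
    indep a (∀-inject₁-fromℕ (λ j → trans (lincomb-init a b j) (ab≈0 j)) (lincomb-coord-zero a b (fromℕ n) last≈0))

  lift-InStd : ∀ {n} i {v : Vect n} → InStd i v → InStd i (lift v)
  lift-InStd {n} i {v} v∈Vᵢ = ∀-inject₁-fromℕ {P = λ j → i ℕ.≤ toℕ j → lift v j ≈ 0#}
    (λ j i≤j → trans (reflexive (snoc-inject₁ v 0# j)) (v∈Vᵢ j (≡.subst (i ℕ.≤_) (toℕ-inject₁ j) i≤j)))
    (λ _ → reflexive (snoc-fromℕ v 0#))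

  init-InStd : ∀ {n} i {v : Vect (suc n)} → InStd i v → InStd i (init v)
  init-InStd i v∈Vᵢ j i≤j = v∈Vᵢ (inject₁ j) (≡.subst (i ℕ.≤_) (≡.sym (toℕ-inject₁ j)) i≤j)

module Enumeration {q : ℕ} (F : FiniteField q) where

  open FiniteField F hiding (zero)
  open LastCoordinate F public
  open import Relation.Binary.Reasoning.Setoid setoid

  module Enum = Bijection enumeration

  index : Carrier → Fin q
  index x = proj₁ (Enum.surjective x)

  to-index : ∀ x → Enum.to (index x) ≈ x
  to-index x = proj₂ (Enum.surjective x) ≡.refl

  _≈?_ : (x y : Carrier) → Dec (x ≈ y)
  x ≈? y with index x Fin.≟ index y
  ... | yes eq = yes (trans (sym (to-index x)) (trans (reflexive (≡.cong Enum.to eq)) (to-index y)))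
  ... | no neq = no (λ x≈y → neq (Enum.injective (trans (to-index x) (trans x≈y (sym (to-index y))))))

  appendCoordinate : ∀ {m n} → (Fin m → Vect n) → Fin (q ℕ.* m) → Vect (suc n)
  appendCoordinate {m} f z = snoc (f (proj₂ (remQuot {q} m z))) (Enum.to (proj₁ (remQuot {q} m z)))

  appendCoordinate-injective : ∀ {m n} {f : Fin m → Vect n} → Injective _≡_ _≋_ f → Injective _≡_ _≋_ (appendCoordinate f)
  appendCoordinate-injective {m} f-inj eq with snoc-injective eq
  ... | f≋ , last≈ = remQuot-injective {q} m (≡.cong₂ _,_ (Enum.injective last≈) (f-inj f≋))

  appendCoordinate-hits : ∀ {m n} (f : Fin m → Vect n) {v z} → f z ≋ init v → appendCoordinate f (combine (index (v (fromℕ n))) z) ≋ v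
  appendCoordinate-hits {n = n} f {v} {z} f≋ t = begin
    appendCoordinate f (combine a z) t  ≡⟨ ≡.cong (λ p → snoc (f (proj₂ p)) (Enum.to (proj₁ p)) t) (remQuot-combine a z) ⟩
    snoc (f z) (Enum.to a) t            ≈⟨ snoc-cong f≋ (to-index (v (fromℕ n))) t ⟩
    snoc (init v) (v (fromℕ n)) t       ≈⟨ snoc-init v t ⟩
    v t                                 ∎
    where a = index (v (fromℕ n))

  vectors : ∀ n → Fin (q ℕ.^ n) → Vect n
  vectors zero    = λ _ ()
  vectors (suc n) = appendCoordinate (vectors n)

  vectors-injective : ∀ n → Injective _≡_ _≋_ (vectors n)
  vectors-injective zero    {zero} {zero} _ = ≡.refl
  vectors-injective (suc n) = appendCoordinate-injective (vectors-injective n)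

  vectors-surjective : ∀ n v → ∃ λ z → vectors n z ≋ v
  vectors-surjective zero    v = zero , (λ ())
  vectors-surjective (suc n) v with vectors-surjective n (init v)
  ... | z , z≋ = combine (index (v (fromℕ n))) z , appendCoordinate-hits (vectors n) z≋

module Elimination {q : ℕ} (F : FiniteField q) where

  open FiniteField F hiding (zero)
  open Enumeration F public
  open import Relation.Binary.Reasoning.Setoid setoid
  open import Algebra.Properties.Ring (CommutativeRing.ring commRing) using (-‿distribˡ-*; //-rightDividesˡ)
  open import Algebra.Properties.CommutativeSemigroup +-commutativeSemigroup using (x∙yz≈xz∙y)

  allZero? : ∀ {ℓ} (f : Fin ℓ → Carrier) → (∀ i → f i ≈ 0#) ⊎ ∃ λ k → ¬ (f k ≈ 0#)
  allZero? f with all? (λ i → f i ≈? 0#)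
  ... | yes f≈0 = inj₁ f≈0
  ... | no  f≉0 = inj₂ (¬∀⟶∃¬ _ _ (λ i → f i ≈? 0#) f≉0)

  -- clears the last coordinate of the other vectors of b against b k
  module Pivoting {n ℓ : ℕ} (b : Fin (suc ℓ) → Vect (suc n)) (k : Fin (suc ℓ)) (bₖ≉0 : ¬ (b k (fromℕ n) ≈ 0#)) where

    x x⁻¹ : Carrier
    x   = b k (fromℕ n)
    x⁻¹ = proj₁ (inverse x bₖ≉0)

    x*x⁻¹≈1 : x * x⁻¹ ≈ 1#
    x*x⁻¹≈1 = proj₂ (inverse x bₖ≉0)

    normalized : Vect (suc n)
    normalized t = x⁻¹ * b k t

    normalized-last : normalized (fromℕ n) ≈ 1#
    normalized-last = trans (*-comm _ _) x*x⁻¹≈1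

    ρ : Fin ℓ → Carrier
    ρ j = b (punchIn k j) (fromℕ n)

    cleared : Fin ℓ → Vect (suc n)
    cleared j t = b (punchIn k j) t - ρ j * normalized t

    cleared-last : ∀ j → cleared j (fromℕ n) ≈ 0#
    cleared-last j = trans (+-congˡ (-‿cong (trans (*-congˡ normalized-last) (*-identityʳ _)))) (-‿inverseʳ _)

    reduced : Fin ℓ → Vect n
    reduced j = init (cleared j)

    lift-reduced : ∀ j → lift (reduced j) ≋ cleared j
    lift-reduced j = lift-init (cleared j) (cleared-last j)

    b-pivot : ∀ t → b k t ≈ x * normalized t
    b-pivot t = begin
      b k t             ≈⟨ *-identityˡ _ ⟨
      1# * b k t        ≈⟨ *-congʳ x*x⁻¹≈1 ⟨
      x * x⁻¹ * b k t   ≈⟨ *-assoc _ _ _ ⟩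
      x * normalized t  ∎

    b-other : ∀ j t → b (punchIn k j) t ≈ cleared j t + ρ j * normalized t
    b-other j t = sym (//-rightDividesˡ (ρ j * normalized t) (b (punchIn k j) t))

    weight : (Fin (suc ℓ) → Carrier) → Carrier
    weight c = c k * x + dot (c ∘ punchIn k) ρ

    lincomb-split : ∀ c t → lincomb c b t ≈ weight c * normalized t + lincomb (c ∘ punchIn k) cleared t
    lincomb-split c t = begin
      lincomb c b t
        ≈⟨ lincomb-punchIn c b k t ⟩
      c k * b k t + lincomb c′ (b ∘ punchIn k) t
        ≡⟨ ≡.cong (c k * b k t +_) (lincomb-coord c′ _ t) ⟩
      c k * b k t + dot c′ (λ j → b (punchIn k j) t)
        ≈⟨ +-cong (*-congˡ (b-pivot t)) (dot-cong (λ _ → refl) (λ j → b-other j t)) ⟩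
      c k * (x * normalized t) + dot c′ (λ j → cleared j t + ρ j * normalized t)
        ≈⟨ +-cong (sym (*-assoc _ _ _)) (trans (dot-distribʳ-+ c′ _ _) (+-congˡ (dot-*ʳ c′ ρ _))) ⟩
      c k * x * normalized t + (dot c′ (λ j → cleared j t) + dot c′ ρ * normalized t)
        ≈⟨ x∙yz≈xz∙y _ _ _ ⟩
      (c k * x * normalized t + dot c′ ρ * normalized t) + dot c′ (λ j → cleared j t)
        ≈⟨ +-cong (sym (distribʳ _ _ _)) (reflexive (≡.sym (lincomb-coord c′ cleared t))) ⟩
      weight c * normalized t + lincomb c′ cleared t ∎
      where c′ = c ∘ punchIn k

    lincomb-weightless : ∀ c → weight c ≈ 0# → lincomb c b ≋ lincomb (c ∘ punchIn k) cleared
    lincomb-weightless c w≈0 t = begin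
      lincomb c b t                                                   ≈⟨ lincomb-split c t ⟩
      weight c * normalized t + lincomb (c ∘ punchIn k) cleared t     ≈⟨ +-congʳ (trans (*-congʳ w≈0) (zeroˡ _)) ⟩
      0# + lincomb (c ∘ punchIn k) cleared t                          ≈⟨ +-identityˡ _ ⟩
      lincomb (c ∘ punchIn k) cleared t                               ∎

    reduced-linIndep : LinIndep b → LinIndep reduced
    reduced-linIndep indep a a·reduced≈0 j =
      trans (reflexive (≡.sym (insertAt-punchIn a k v j))) (indep c c·b≈0 (punchIn k j))
      where
      v = - (dot a ρ * x⁻¹)
      c = insertAt a k v
      c∘punchIn≈a : ∀ j → c (punchIn k j) ≈ a j
      c∘punchIn≈a j = reflexive (insertAt-punchIn a k v j)
      weight≈0 : weight c ≈ 0#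
      weight≈0 = begin
        c k * x + dot (c ∘ punchIn k) ρ  ≈⟨ +-cong (*-congʳ (reflexive (insertAt-lookup a k v))) (dot-cong c∘punchIn≈a (λ _ → refl)) ⟩
        v * x + dot a ρ                  ≈⟨ +-congʳ (sym (-‿distribˡ-* _ _)) ⟩
        - (dot a ρ * x⁻¹ * x) + dot a ρ  ≈⟨ +-congʳ (-‿cong (trans (*-assoc _ _ _) (trans (*-congˡ normalized-last) (*-identityʳ _)))) ⟩
        - dot a ρ + dot a ρ              ≈⟨ -‿inverseˡ _ ⟩
        0#                               ∎
      a·cleared≈0 : lincomb a cleared ≋ 0v
      a·cleared≈0 = ∀-inject₁-fromℕ (λ t → trans (lincomb-init a cleared t) (a·reduced≈0 t))
                                    (lincomb-coord-zero a cleared (fromℕ n) cleared-last)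
      c·b≈0 : lincomb c b ≋ 0v
      c·b≈0 t = trans (lincomb-weightless c weight≈0 t) (trans (lincomb-cong cleared c∘punchIn≈a t) (a·cleared≈0 t))

    init-InSpan-reduced : ∀ {v} → InSpan b v → v (fromℕ n) ≈ 0# → InSpan reduced (init v)
    init-InSpan-reduced {v} (c , v≋cb) v-last≈0 =
      c ∘ punchIn k , (λ t → trans (v≋cb (inject₁ t)) (trans (lincomb-weightless c weight≈0 (inject₁ t)) (lincomb-init _ cleared t)))
      where
      weight≈0 : weight c ≈ 0#
      weight≈0 = begin
        weight c                                                              ≈⟨ *-identityʳ _ ⟨
        weight c * 1#                                                         ≈⟨ *-congˡ normalized-last ⟨
        weight c * normalized (fromℕ n)                                       ≈⟨ +-identityʳ _ ⟨
        weight c * normalized (fromℕ n) + 0#                                  ≈⟨ +-congˡ (lincomb-coord-zero _ cleared (fromℕ n) cleared-last) ⟨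
        weight c * normalized (fromℕ n) + lincomb (c ∘ punchIn k) cleared (fromℕ n) ≈⟨ lincomb-split c (fromℕ n) ⟨
        lincomb c b (fromℕ n)                                                 ≈⟨ v≋cb (fromℕ n) ⟨
        v (fromℕ n)                                                           ≈⟨ v-last≈0 ⟩
        0#                                                                    ∎

    normalized-InSpan : InSpan b normalized
    normalized-InSpan = ·∈ (span b) x⁻¹ (∈-span b k)

    cleared-InSpan : ∀ j → InSpan b (cleared j)
    cleared-InSpan j = resp (span b) (λ t → +-congˡ (sym (-‿distribˡ-* _ _)))
                         (+∈ (span b) (∈-span b (punchIn k j)) (·∈ (span b) (- ρ j) normalized-InSpan))

    lift-InSpan-reduced : ∀ {v} → InSpan reduced v → InSpan b (lift v)
    lift-InSpan-reduced {v} (a , v≋) =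
      resp (span b) (λ t → sym (trans (snoc-cong v≋ refl t) (trans (lift-lincomb a reduced t) (lincomb-congʳ a lift-reduced t))))
           (member-lincomb (span b) a cleared cleared-InSpan)

    ⊇-family : (L : Subspace (suc n)) → member L normalized → (∀ j → member L (cleared j)) → ∀ i → member L (b i)
    ⊇-family L w∈L cleared∈L i with i Fin.≟ k
    ... | yes ≡.refl = resp L (λ t → sym (b-pivot t)) (·∈ L x w∈L)
    ... | no  i≢k = ≡.subst (λ i → member L (b i)) (punchIn-punchOut k≢i)
                      (resp L (λ t → sym (b-other j t)) (+∈ L (cleared∈L j) (·∈ L (ρ j) w∈L)))
      where
      k≢i = λ k≡i → i≢k (≡.sym k≡i)
      j = Fin.punchOut k≢i

  linIndep⇒≤ : ∀ {N ℓ} (b : Fin ℓ → Vect N) → LinIndep b → ℓ ℕ.≤ N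
  linIndep⇒≤ {N}     {zero}  b indep = ℕ.z≤n
  linIndep⇒≤ {zero}  {suc ℓ} b indep = ⊥-elim (1≉0 (indep (unitVector zero) (λ ()) zero))
  linIndep⇒≤ {suc N} {suc ℓ} b indep with allZero? (λ i → b i (fromℕ N))
  ... | inj₁ last≈0      = m≤n⇒m≤1+n (linIndep⇒≤ (init ∘ b) (init-linIndep {b = b} last≈0 indep))
  ... | inj₂ (k , bₖ≉0)  = ℕ.s≤s (linIndep⇒≤ reduced (reduced-linIndep indep))
    where open Pivoting b k bₖ≉0

  ¬linIndep-⊆-smaller : ∀ {N ℓ} (v : Fin ℓ → Vect N) (u : Fin (suc ℓ) → Vect N) → (∀ j → InSpan v (u j)) → ¬ LinIndep u
  ¬linIndep-⊆-smaller {ℓ = ℓ} v u u⊆v indep = <-irrefl ≡.refl (linIndep⇒≤ coords coords-linIndep)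
    where
    coords : Fin (suc ℓ) → Vect ℓ
    coords j = proj₁ (u⊆v j)
    coords-linIndep : LinIndep coords
    coords-linIndep a a·coords≈0 = indep a (λ t → begin
      lincomb a u t                              ≈⟨ lincomb-congʳ a (λ j → proj₂ (u⊆v j)) t ⟩
      lincomb a (λ j → lincomb (coords j) v) t   ≈⟨ lincomb-lincomb a coords v t ⟨
      lincomb (lincomb a coords) v t             ≈⟨ lincomb-cong v a·coords≈0 t ⟩
      lincomb (λ _ → 0#) v t                     ≈⟨ lincomb-zero v t ⟩
      0#                                         ∎)

-- Reduced echelon bases and the count #Ω

[_]·_ : ∀ {p} {P : Set p} → Dec P → ℕ → ℕ
[ yes _ ]· x = x
[ no  _ ]· x = 0

-- |Ω_α(ℓ, V_n)|, split according to whether coordinate n is a pivot (α is 0-based: α i is α_{i+1})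
#Ω : ℕ → ℕ → ℕ → (ℕ → ℕ) → ℕ
#Ω q zero    n       α = 1
#Ω q (suc ℓ) zero    α = 0
#Ω q (suc ℓ) (suc n) α = #Ω q (suc ℓ) n α ℕ.+ [ suc n ℕ.≤? α ℓ ]· (#Ω q ℓ n α ℕ.* q ℕ.^ (n ℕ.∸ ℓ))

module EchelonForm {q : ℕ} (F : FiniteField q) (α : ℕ → ℕ) where

  open FiniteField F hiding (zero)
  open Elimination F public
  open import Relation.Binary.Reasoning.Setoid setoid
  open import Algebra.Properties.Ring (CommutativeRing.ring commRing) using (\\-leftDividesˡ; //-rightDividesˡ; -1*x≈-x)

  data Echelon : ℕ → ℕ → Set
  IsPivot : ∀ {ℓ n} → Echelon ℓ n → Fin n → Set

  -- Reduced column echelon bases of the ℓ-dimensional subspaces of V_n whose i-th pivot lies in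
  -- V_{α i}: coordinate n is either no pivot, or the pivot of a new basis vector (c , 1) with c
  -- vanishing at the earlier pivots.
  data Echelon where
    []    : ∀ {n} → Echelon 0 n
    skip  : ∀ {ℓ n} → Echelon (suc ℓ) n → Echelon (suc ℓ) (suc n)
    pivot : ∀ {ℓ n} → suc n ℕ.≤ α ℓ → (e : Echelon ℓ n) (c : Vect n) →
            (∀ j → IsPivot e j → c j ≈ 0#) → Echelon (suc ℓ) (suc n)

  IsPivot []              = λ _ → ⊥
  IsPivot (skip e)        = snoc (IsPivot e) ⊥
  IsPivot (pivot _ e _ _) = snoc (IsPivot e) ⊤

  basis : ∀ {ℓ n} → Echelon ℓ n → Fin ℓ → Vect n
  basis []              = λ ()
  basis (skip e)        = lift ∘ basis e
  basis (pivot _ e c _) = snoc c 1# ∷ lift ∘ basis e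

  echelon-≤ : ∀ {ℓ n} → Echelon ℓ n → ℓ ℕ.≤ n
  echelon-≤ []              = ℕ.z≤n
  echelon-≤ (skip e)        = m≤n⇒m≤1+n (echelon-≤ e)
  echelon-≤ (pivot _ e _ _) = ℕ.s≤s (echelon-≤ e)

  module _ {ℓ n : ℕ} (fits : suc n ℕ.≤ α ℓ) (e : Echelon ℓ n) (c : Vect n) (c-reduced : ∀ j → IsPivot e j → c j ≈ 0#) where

    lincomb-pivot-fromℕ : ∀ a → lincomb a (basis (pivot fits e c c-reduced)) (fromℕ n) ≈ a zero
    lincomb-pivot-fromℕ a = begin
      a zero * snoc c 1# (fromℕ n) + lincomb (a ∘ suc) (lift ∘ basis e) (fromℕ n)
        ≈⟨ +-cong (*-congˡ (reflexive (snoc-fromℕ c 1#))) (lincomb-lift-fromℕ _ (basis e)) ⟩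
      a zero * 1# + 0#
        ≈⟨ trans (+-identityʳ _) (*-identityʳ _) ⟩
      a zero ∎

    lincomb-pivot-inject₁ : ∀ a j → lincomb a (basis (pivot fits e c c-reduced)) (inject₁ j) ≈ a zero * c j + lincomb (a ∘ suc) (basis e) j
    lincomb-pivot-inject₁ a j = +-cong (*-congˡ (reflexive (snoc-inject₁ c 1# j))) (lincomb-lift-inject₁ _ (basis e) j)

    lincomb-pivot-inject₁-tail : ∀ a → a zero ≈ 0# → ∀ j →
                                 lincomb a (basis (pivot fits e c c-reduced)) (inject₁ j) ≈ lincomb (a ∘ suc) (basis e) j
    lincomb-pivot-inject₁-tail a a₀≈0 j = begin
      lincomb a (basis (pivot fits e c c-reduced)) (inject₁ j) ≈⟨ lincomb-pivot-inject₁ a j ⟩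
      a zero * c j + lincomb (a ∘ suc) (basis e) j             ≈⟨ +-congʳ (trans (*-congʳ a₀≈0) (zeroˡ _)) ⟩
      0# + lincomb (a ∘ suc) (basis e) j                       ≈⟨ +-identityˡ _ ⟩
      lincomb (a ∘ suc) (basis e) j                            ∎

    lift-InSpan-pivot : ∀ {v} → InSpan (basis e) v → InSpan (basis (pivot fits e c c-reduced)) (lift v)
    lift-InSpan-pivot (a , v≋) =
      0# ∷ a , (λ j → trans (proj₂ (lift-InSpan {b = basis e} (a , v≋)) j) (sym (trans (+-congʳ (zeroˡ _)) (+-identityˡ _))))

  zeroAtPivots⇒zero : ∀ {ℓ n} (e : Echelon ℓ n) a → (∀ j → IsPivot e j → lincomb a (basis e) j ≈ 0#) → ∀ i → a i ≈ 0#
  zeroAtPivots⇒zero []       a _        ()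
  zeroAtPivots⇒zero (skip e) a vanishes = zeroAtPivots⇒zero e a (λ j pj →
    trans (sym (lincomb-lift-inject₁ a (basis e) j)) (vanishes (inject₁ j) (snoc-inject₁⁺ (IsPivot e) ⊥ pj)))
  zeroAtPivots⇒zero {n = suc n} (pivot fits e c c-red) a vanishes = λ { zero → a₀≈0 ; (suc i) → tail≈0 i }
    where
    a₀≈0 : a zero ≈ 0#
    a₀≈0 = trans (sym (lincomb-pivot-fromℕ fits e c c-red a)) (vanishes (fromℕ n) (snoc-fromℕ⁺ (IsPivot e) ⊤ tt))
    tail≈0 : ∀ i → a (suc i) ≈ 0#
    tail≈0 = zeroAtPivots⇒zero e (a ∘ suc) (λ j pj →
      trans (sym (lincomb-pivot-inject₁-tail fits e c c-red a a₀≈0 j)) (vanishes (inject₁ j) (snoc-inject₁⁺ (IsPivot e) ⊤ pj)))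

  basis-linIndep : ∀ {ℓ n} (e : Echelon ℓ n) → LinIndep (basis e)
  basis-linIndep e a a·e≈0 = zeroAtPivots⇒zero e a (λ j _ → a·e≈0 j)

  matchAtPivots : ∀ {ℓ n} (e : Echelon ℓ n) (v : Vect n) → ∃ λ d → ∀ j → IsPivot e j → v j ≈ lincomb d (basis e) j
  matchAtPivots [] v = (λ ()) , (λ j ())
  matchAtPivots (skip e) v with matchAtPivots e (init v)
  ... | d , v≈ = d , ∀-inject₁-fromℕ
    (λ j pj → trans (v≈ j (snoc-inject₁⁻ (IsPivot e) ⊥ pj)) (sym (lincomb-lift-inject₁ d (basis e) j)))
    (λ pn → ⊥-elim (snoc-fromℕ⁻ (IsPivot e) ⊥ pn))
  matchAtPivots {n = suc n} (pivot fits e c c-red) v with matchAtPivots e (λ j → - (v (fromℕ n) * c j) + v (inject₁ j))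
  ... | d , v≈ = v (fromℕ n) ∷ d , ∀-inject₁-fromℕ
    (λ j pj → begin
      v (inject₁ j)                                                   ≈⟨ \\-leftDividesˡ _ _ ⟨
      v (fromℕ n) * c j + (- (v (fromℕ n) * c j) + v (inject₁ j))     ≈⟨ +-congˡ (v≈ j (snoc-inject₁⁻ (IsPivot e) ⊤ pj)) ⟩
      v (fromℕ n) * c j + lincomb d (basis e) j                       ≈⟨ lincomb-pivot-inject₁ fits e c c-red (v (fromℕ n) ∷ d) j ⟨
      lincomb (v (fromℕ n) ∷ d) (basis (pivot fits e c c-red)) (inject₁ j) ∎)
    (λ _ → sym (lincomb-pivot-fromℕ fits e c c-red (v (fromℕ n) ∷ d)))

  _≈ᴱ_ : ∀ {ℓ n} → Echelon ℓ n → Echelon ℓ n → Set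
  []            ≈ᴱ []              = ⊤
  skip e        ≈ᴱ skip e′         = e ≈ᴱ e′
  pivot _ e c _ ≈ᴱ pivot _ e′ c′ _ = e ≈ᴱ e′ × c ≋ c′
  _             ≈ᴱ _               = ⊥

  isPivot-cong : ∀ {ℓ n} (e e′ : Echelon ℓ n) → e ≈ᴱ e′ → ∀ j → IsPivot e j → IsPivot e′ j
  isPivot-cong [] [] _ j ()
  isPivot-cong (skip e) (skip e′) e≈e′ = ∀-inject₁-fromℕ {P = λ j → IsPivot (skip e) j → IsPivot (skip e′) j}
    (λ j pj → snoc-inject₁⁺ (IsPivot e′) ⊥ (isPivot-cong e e′ e≈e′ j (snoc-inject₁⁻ (IsPivot e) ⊥ pj)))
    (λ pn → ⊥-elim (snoc-fromℕ⁻ (IsPivot e) ⊥ pn))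
  isPivot-cong (pivot fits e c c-red) (pivot fits′ e′ c′ c′-red) (e≈e′ , _) =
    ∀-inject₁-fromℕ {P = λ j → IsPivot (pivot fits e c c-red) j → IsPivot (pivot fits′ e′ c′ c′-red) j}
      (λ j pj → snoc-inject₁⁺ (IsPivot e′) ⊤ (isPivot-cong e e′ e≈e′ j (snoc-inject₁⁻ (IsPivot e) ⊤ pj)))
      (λ _ → snoc-fromℕ⁺ (IsPivot e′) ⊤ tt)

  basis-cong : ∀ {ℓ n} (e e′ : Echelon ℓ n) → e ≈ᴱ e′ → ∀ i → basis e i ≋ basis e′ i
  basis-cong [] [] _ ()
  basis-cong (skip e) (skip e′) e≈e′ i = snoc-cong (basis-cong e e′ e≈e′ i) refl
  basis-cong (pivot _ e c _) (pivot _ e′ c′ _) (e≈e′ , c≋c′) zero    = snoc-cong c≋c′ refl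
  basis-cong (pivot _ e c _) (pivot _ e′ c′ _) (e≈e′ , c≋c′) (suc i) = snoc-cong (basis-cong e e′ e≈e′ i) refl

  _⊑_ : ∀ {ℓ ℓ′ n} → (Fin ℓ → Vect n) → (Fin ℓ′ → Vect n) → Set
  b ⊑ b′ = ∀ i → InSpan b′ (b i)

  pivotVector-∉-lifted : ∀ {n k} (b : Fin k → Vect n) c → ¬ InSpan (lift ∘ b) (snoc c 1#)
  pivotVector-∉-lifted {n} b c (a , c1≋) =
    1≉0 (trans (reflexive (≡.sym (snoc-fromℕ c 1#))) (trans (c1≋ (fromℕ n)) (lincomb-lift-fromℕ a b)))

  module _ {ℓ n : ℕ} (fits fits′ : suc n ℕ.≤ α ℓ) (e e′ : Echelon ℓ n) (c c′ : Vect n)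
           (c-red : ∀ j → IsPivot e j → c j ≈ 0#) (c′-red : ∀ j → IsPivot e′ j → c′ j ≈ 0#) where

    private
      E E′ : Echelon (suc ℓ) (suc n)
      E  = pivot fits e c c-red
      E′ = pivot fits′ e′ c′ c′-red

    pivot-⊑⁻ : basis E ⊑ basis E′ → basis e ⊑ basis e′
    pivot-⊑⁻ E⊑E′ i with E⊑E′ (suc i)
    ... | a , eᵢ≋ = a ∘ suc , (λ j → begin
      basis e i j                                  ≈⟨ reflexive (≡.sym (snoc-inject₁ (basis e i) 0# j)) ⟩
      lift (basis e i) (inject₁ j)                 ≈⟨ eᵢ≋ (inject₁ j) ⟩
      lincomb a (basis E′) (inject₁ j)             ≈⟨ lincomb-pivot-inject₁-tail fits′ e′ c′ c′-red a a₀≈0 j ⟩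
      lincomb (a ∘ suc) (basis e′) j               ∎)
      where
      a₀≈0 : a zero ≈ 0#
      a₀≈0 = trans (sym (lincomb-pivot-fromℕ fits′ e′ c′ c′-red a)) (trans (sym (eᵢ≋ (fromℕ n))) (reflexive (snoc-fromℕ (basis e i) 0#)))

    -- Subtracting (c′ , 1) from (c , 1) leaves a combination of e′ vanishing at the pivots of e′.
    pivotVector-unique : e′ ≈ᴱ e → basis E ⊑ basis E′ → c ≋ c′
    pivotVector-unique e′≈e E⊑E′ with E⊑E′ zero
    ... | a , c1≋ = λ t → begin
      c t            ≈⟨ c≈c′+rest t ⟩
      c′ t + rest t  ≈⟨ +-congˡ (trans (lincomb-cong (basis e′) tail≈0 t) (lincomb-zero (basis e′) t)) ⟩
      c′ t + 0#      ≈⟨ +-identityʳ _ ⟩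
      c′ t           ∎
      where
      rest : Vect n
      rest = lincomb (a ∘ suc) (basis e′)
      a₀≈1 : a zero ≈ 1#
      a₀≈1 = trans (sym (lincomb-pivot-fromℕ fits′ e′ c′ c′-red a)) (trans (sym (c1≋ (fromℕ n))) (reflexive (snoc-fromℕ c 1#)))
      c≈c′+rest : ∀ t → c t ≈ c′ t + rest t
      c≈c′+rest t = begin
        c t                                ≈⟨ reflexive (≡.sym (snoc-inject₁ c 1# t)) ⟩
        snoc c 1# (inject₁ t)              ≈⟨ c1≋ (inject₁ t) ⟩
        lincomb a (basis E′) (inject₁ t)   ≈⟨ lincomb-pivot-inject₁ fits′ e′ c′ c′-red a t ⟩
        a zero * c′ t + rest t             ≈⟨ +-congʳ (trans (*-congʳ a₀≈1) (*-identityˡ _)) ⟩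
        c′ t + rest t                      ∎
      tail≈0 : ∀ i → a (suc i) ≈ 0#
      tail≈0 = zeroAtPivots⇒zero e′ (a ∘ suc) (λ t pt → begin
        rest t          ≈⟨ +-identityˡ _ ⟨
        0# + rest t     ≈⟨ +-congʳ (c′-red t pt) ⟨
        c′ t + rest t   ≈⟨ c≈c′+rest t ⟨
        c t             ≈⟨ c-red t (isPivot-cong e′ e e′≈e t pt) ⟩
        0#              ∎)

  span-injective : ∀ {ℓ n} (e e′ : Echelon ℓ n) → basis e ⊑ basis e′ → basis e′ ⊑ basis e → e ≈ᴱ e′
  span-injective [] [] _ _ = tt
  span-injective (skip e) (skip e′) e⊑e′ e′⊑e =
    span-injective e e′ (λ i → lift-InSpan⁻ {b = basis e′} (e⊑e′ i)) (λ i → lift-InSpan⁻ {b = basis e} (e′⊑e i))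
  span-injective (skip e) (pivot _ e′ c′ _) _ e′⊑e = ⊥-elim (pivotVector-∉-lifted (basis e) c′ (e′⊑e zero))
  span-injective (pivot _ e c _) (skip e′) e⊑e′ _ = ⊥-elim (pivotVector-∉-lifted (basis e′) c (e⊑e′ zero))
  span-injective (pivot fits e c c-red) (pivot fits′ e′ c′ c′-red) E⊑E′ E′⊑E =
    span-injective e e′ e⊑e′ e′⊑e ,
    pivotVector-unique fits fits′ e e′ c c′ c-red c′-red (span-injective e′ e e′⊑e e⊑e′) E⊑E′
    where
    e⊑e′ = pivot-⊑⁻ fits fits′ e e′ c c′ c-red c′-red E⊑E′
    e′⊑e = pivot-⊑⁻ fits′ fits e′ e c′ c c′-red c-red E′⊑E

  Condition : ∀ {n} → Subspace n → ℕ → Set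
  Condition L i = DimCapAtLeast L (α i) (suc i)

  Conditions : ∀ {n} ℓ → Subspace n → Set
  Conditions ℓ L = ∀ (i : Fin ℓ) → Condition L (toℕ i)

  dimCap-lift : ∀ {n k k′ i d} {b : Fin k → Vect n} {b′ : Fin k′ → Vect (suc n)} →
                (∀ {v} → InSpan b v → InSpan b′ (lift v)) → DimCapAtLeast (span b) i d → DimCapAtLeast (span b′) i d
  dimCap-lift {i = i} lift-⊆ (u , u-indep , u∈) =
    lift ∘ u , lift-linIndep u-indep , (λ j → lift-⊆ (proj₁ (u∈ j)) , lift-InStd i (proj₂ (u∈ j)))

  basis-conditions : ∀ {ℓ n} (e : Echelon ℓ n) → Conditions ℓ (span (basis e))
  basis-conditions [] ()
  basis-conditions (skip e) i = dimCap-lift {b = basis e} {b′ = basis (skip e)} (lift-InSpan {b = basis e}) (basis-conditions e i)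
  basis-conditions {suc ℓ} {suc n} (pivot fits e c c-red) = ∀-inject₁-fromℕ {P = Condition L ∘ toℕ}
    (λ i → ≡.subst (Condition L) (≡.sym (toℕ-inject₁ i))
             (dimCap-lift {b = basis e} {b′ = basis E} (lift-InSpan-pivot fits e c c-red) (basis-conditions e i)))
    (≡.subst (Condition L) (≡.sym (toℕ-fromℕ ℓ)) whole)
    where
    E = pivot fits e c c-red
    L = span (basis E)
    -- every vector of V_{n+1} lies in V_{α ℓ}
    whole : Condition L ℓ
    whole = basis E , basis-linIndep E ,
            (λ j → ∈-span (basis E) j , (λ t αℓ≤t → ⊥-elim (<-irrefl ≡.refl (<-≤-trans (toℕ<n t) (≤-trans fits αℓ≤t)))))

  SameSpan : ∀ {ℓ ℓ′ n} → (Fin ℓ → Vect n) → (Fin ℓ′ → Vect n) → Set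
  SameSpan b b′ = b ⊑ b′ × b′ ⊑ b

  module ZeroLastStep {n ℓ : ℕ} (b : Fin ℓ → Vect (suc n)) (last≈0 : ∀ i → b i (fromℕ n) ≈ 0#) where

    InSpan-last≈0 : ∀ {v} → InSpan b v → v (fromℕ n) ≈ 0#
    InSpan-last≈0 (c , v≋) = trans (v≋ (fromℕ n)) (lincomb-coord-zero c b (fromℕ n) last≈0)

    conditions-init : Conditions ℓ (span b) → Conditions ℓ (span (init ∘ b))
    conditions-init conds i with conds i
    ... | u , u-indep , u∈ =
      init ∘ u , init-linIndep {b = u} (λ j → InSpan-last≈0 (proj₁ (u∈ j))) u-indep ,
      (λ j → init-InSpan {b = b} (proj₁ (u∈ j)) , init-InStd (α (toℕ i)) (proj₂ (u∈ j)))

    lift-init-b : ∀ i → lift (init (b i)) ≋ b i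
    lift-init-b i = lift-init (b i) (last≈0 i)

    sameSpan-lift : ∀ {k} {b′ : Fin k → Vect n} → SameSpan b′ (init ∘ b) → SameSpan (lift ∘ b′) b
    sameSpan-lift {b′ = b′} (b′⊑ , ⊑b′) =
      (λ i → InSpan-cong lift-init-b (lift-InSpan {b = init ∘ b} (b′⊑ i))) ,
      (λ i → resp (span (lift ∘ b′)) (lift-init-b i) (lift-InSpan {b = b′} (⊑b′ i)))

  module PivotStep {n ℓ : ℕ} (b : Fin (suc ℓ) → Vect (suc n)) (indep : LinIndep b) (conds : Conditions (suc ℓ) (span b))
                   (k : Fin (suc ℓ)) (bₖ≉0 : ¬ (b k (fromℕ n) ≈ 0#)) where

    open Pivoting b k bₖ≉0 public

    conditions-reduced : Conditions ℓ (span reduced)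
    conditions-reduced i = reduce (≡.subst (Condition (span b)) (toℕ-inject₁ i) (conds (inject₁ i)))
      where
      reduce : Condition (span b) (toℕ i) → Condition (span reduced) (toℕ i)
      reduce (u , u-indep , u∈) with α (toℕ i) ℕ.≤? n
      ... | yes αᵢ≤n = init ∘ u , init-linIndep {b = u} last≈0 u-indep ,
                       (λ j → init-InSpan-reduced (proj₁ (u∈ j)) (last≈0 j) , init-InStd (α (toℕ i)) (proj₂ (u∈ j)))
        where
        last≈0 : ∀ j → u j (fromℕ n) ≈ 0#
        last≈0 j = proj₂ (u∈ j) (fromℕ n) (≡.subst (α (toℕ i) ℕ.≤_) (≡.sym (toℕ-fromℕ n)) αᵢ≤n)
      -- when V_{α i} contains all of V_n, the first i + 1 reduced vectors witness the condition
      ... | no αᵢ≰n = (λ j → reduced (inject≤ j (toℕ<n i))) , linIndep-prefix (toℕ<n i) (reduced-linIndep indep) ,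
                      (λ j → ∈-span reduced _ , (λ t αᵢ≤t → ⊥-elim (αᵢ≰n (≤-trans αᵢ≤t (<⇒≤ (toℕ<n t))))))

    pivot-fits : suc n ℕ.≤ α ℓ
    pivot-fits with suc n ℕ.≤? α ℓ
    ... | yes fits = fits
    ... | no ¬fits = ⊥-elim (too-many (≡.subst (Condition (span b)) (toℕ-fromℕ ℓ) (conds (fromℕ ℓ))))
      where
      -- otherwise ℓ + 1 independent vectors of span b would lie in V_n, hence in the span of the ℓ reduced vectors
      too-many : ¬ Condition (span b) ℓ
      too-many (u , u-indep , u∈) = ¬linIndep-⊆-smaller reduced (init ∘ u)
        (λ j → init-InSpan-reduced (proj₁ (u∈ j)) (last≈0 j)) (init-linIndep {b = u} last≈0 u-indep)
        where
        last≈0 : ∀ j → u j (fromℕ n) ≈ 0#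
        last≈0 j = proj₂ (u∈ j) (fromℕ n) (≡.subst (α ℓ ℕ.≤_) (≡.sym (toℕ-fromℕ n)) (≤-pred (≰⇒> ¬fits)))

    module Extend (e′ : Echelon ℓ n) (e′∼reduced : SameSpan (basis e′) reduced) where

      private
        match = matchAtPivots e′ (init normalized)

        L : Vect n
        L = lincomb (proj₁ match) (basis e′)

        L∈reduced : InSpan reduced L
        L∈reduced = member-lincomb (span reduced) (proj₁ match) (basis e′) (proj₁ e′∼reduced)

      -- normalized, cleared at the pivots of e′ by subtracting the combination L of e′
      c : Vect n
      c t = init normalized t - L t

      c-reduced : ∀ j → IsPivot e′ j → c j ≈ 0#
      c-reduced j pj = trans (+-congʳ (proj₂ match j pj)) (-‿inverseʳ _)

      echelon : Echelon (suc ℓ) (suc n)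
      echelon = pivot pivot-fits e′ c c-reduced

      echelon⊑b : basis echelon ⊑ b
      echelon⊑b zero = resp (span b) pivotVector≋ (+∈ (span b) normalized-InSpan (·∈ (span b) (- 1#) (lift-InSpan-reduced L∈reduced)))
        where
        pivotVector≋ : (normalized +v ((- 1#) ·v lift L)) ≋ snoc c 1#
        pivotVector≋ = ∀-inject₁-fromℕ
          (λ t → trans (+-congˡ (trans (-1*x≈-x _) (-‿cong (reflexive (snoc-inject₁ L 0# t))))) (reflexive (≡.sym (snoc-inject₁ c 1# t))))
          (trans (+-cong normalized-last (trans (*-congˡ (reflexive (snoc-fromℕ L 0#))) (zeroʳ _)))
                 (trans (+-identityʳ _) (reflexive (≡.sym (snoc-fromℕ c 1#)))))
      echelon⊑b (suc i) = lift-InSpan-reduced (proj₁ e′∼reduced i)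

      b⊑echelon : b ⊑ basis echelon
      b⊑echelon = ⊇-family (span (basis echelon)) normalized∈ cleared∈
        where
        normalized≋ : (snoc c 1# +v lift L) ≋ normalized
        normalized≋ = ∀-inject₁-fromℕ
          (λ t → trans (+-cong (reflexive (snoc-inject₁ c 1# t)) (reflexive (snoc-inject₁ L 0# t))) (//-rightDividesˡ _ _))
          (trans (+-cong (reflexive (snoc-fromℕ c 1#)) (reflexive (snoc-fromℕ L 0#))) (trans (+-identityʳ _) (sym normalized-last)))
        normalized∈ : InSpan (basis echelon) normalized
        normalized∈ = resp (span (basis echelon)) normalized≋
          (+∈ (span (basis echelon)) (∈-span (basis echelon) zero) (lift-InSpan-pivot pivot-fits e′ c c-reduced (proj₁ match , λ _ → refl)))
        cleared∈ : ∀ j → InSpan (basis echelon) (cleared j)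
        cleared∈ j = resp (span (basis echelon)) (lift-reduced j) (lift-InSpan-pivot pivot-fits e′ c c-reduced (proj₂ e′∼reduced j))

  echelonize : ∀ {n ℓ} (b : Fin ℓ → Vect n) → LinIndep b → Conditions ℓ (span b) → Σ (Echelon ℓ n) λ e → SameSpan (basis e) b
  echelonize {n}     {zero}  b _ _ = [] , (λ ()) , (λ ())
  echelonize {zero}  {suc ℓ} b indep _ with linIndep⇒≤ b indep
  ... | ()
  echelonize {suc n} {suc ℓ} b indep conds with allZero? (λ i → b i (fromℕ n))
  ... | inj₁ last≈0 = skip e , sameSpan-lift e∼init
    where
    open ZeroLastStep b last≈0
    rec = echelonize (init ∘ b) (init-linIndep {b = b} last≈0 indep) (conditions-init conds)
    e = proj₁ rec
    e∼init = proj₂ rec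
  ... | inj₂ (k , bₖ≉0) = echelon , echelon⊑b , b⊑echelon
    where
    open PivotStep b indep conds k bₖ≉0
    rec = echelonize reduced (reduced-linIndep indep) conditions-reduced
    open Extend (proj₁ rec) (proj₂ rec)

  free-suc : ∀ {ℓ n} → Echelon (suc ℓ) n → q ℕ.^ (n ℕ.∸ ℓ) ≡ q ℕ.* q ℕ.^ (n ℕ.∸ suc ℓ)
  free-suc {ℓ} {n} e = ≡.cong (q ℕ.^_) (∸-suc (echelon-≤ e))

  -- enumerates the possible c of a new pivot vector (c , 1) over e
  offPivot : ∀ {ℓ n} (e : Echelon ℓ n) → Fin (q ℕ.^ (n ℕ.∸ ℓ)) → Vect n
  offPivot {n = n} []    = vectors n
  offPivot (skip e)        = appendCoordinate (offPivot e) ∘ cast (free-suc e)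
  offPivot (pivot _ e _ _) = lift ∘ offPivot e

  offPivot-vanishes : ∀ {ℓ n} (e : Echelon ℓ n) z j → IsPivot e j → offPivot e z j ≈ 0#
  offPivot-vanishes [] z j ()
  offPivot-vanishes (skip e) z = ∀-inject₁-fromℕ {P = λ j → IsPivot (skip e) j → offPivot (skip e) z j ≈ 0#}
    (λ j pj → trans (reflexive (snoc-inject₁ _ _ j)) (offPivot-vanishes e _ j (snoc-inject₁⁻ (IsPivot e) ⊥ pj)))
    (λ pn → ⊥-elim (snoc-fromℕ⁻ (IsPivot e) ⊥ pn))
  offPivot-vanishes (pivot fits e c c-red) z =
    ∀-inject₁-fromℕ {P = λ j → IsPivot (pivot fits e c c-red) j → offPivot (pivot fits e c c-red) z j ≈ 0#}
    (λ j pj → trans (reflexive (snoc-inject₁ (offPivot e z) 0# j)) (offPivot-vanishes e z j (snoc-inject₁⁻ (IsPivot e) ⊤ pj)))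
    (λ _ → reflexive (snoc-fromℕ (offPivot e z) 0#))

  offPivot-injective : ∀ {ℓ n} (e : Echelon ℓ n) → Injective _≡_ _≋_ (offPivot e)
  offPivot-injective {n = n} []    = vectors-injective n
  offPivot-injective (skip e)        eq = cast-injective (free-suc e) (appendCoordinate-injective (offPivot-injective e) eq)
  offPivot-injective (pivot _ e _ _) eq = offPivot-injective e (proj₁ (snoc-injective eq))

  offPivot-surjective : ∀ {ℓ n} (e : Echelon ℓ n) v → (∀ j → IsPivot e j → v j ≈ 0#) → ∃ λ z → offPivot e z ≋ v
  offPivot-surjective {n = n} [] v _ = vectors-surjective n v
  offPivot-surjective {n = suc n} (skip e) v v-red with offPivot-surjective e (init v) (λ j pj → v-red (inject₁ j) (snoc-inject₁⁺ (IsPivot e) ⊥ pj))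
  ... | z , z≋ = cast (≡.sym (free-suc e)) z₀ ,
                 (λ t → trans (reflexive (≡.cong (λ z → appendCoordinate (offPivot e) z t) (cast-involutive (free-suc e) (≡.sym (free-suc e)) z₀)))
                              (appendCoordinate-hits (offPivot e) z≋ t))
    where z₀ = combine (index (v (fromℕ n))) z
  offPivot-surjective {n = suc n} (pivot _ e _ _) v v-red with offPivot-surjective e (init v) (λ j pj → v-red (inject₁ j) (snoc-inject₁⁺ (IsPivot e) ⊤ pj))
  ... | z , z≋ = z , (λ t → trans (snoc-cong z≋ refl t) (lift-init v (v-red (fromℕ n) (snoc-fromℕ⁺ (IsPivot e) ⊤ tt)) t))

  enumerate : ∀ ℓ n → Fin (#Ω q ℓ n α) → Echelon ℓ n
  enumerate-last : ∀ ℓ n (fits? : Dec (suc n ℕ.≤ α ℓ)) →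
                   Fin (#Ω q (suc ℓ) n α) ⊎ Fin ([ fits? ]· (#Ω q ℓ n α ℕ.* q ℕ.^ (n ℕ.∸ ℓ))) → Echelon (suc ℓ) (suc n)
  newPivot : ∀ ℓ n → suc n ℕ.≤ α ℓ → Fin (#Ω q ℓ n α) × Fin (q ℕ.^ (n ℕ.∸ ℓ)) → Echelon (suc ℓ) (suc n)

  enumerate zero    n       _ = []
  enumerate (suc ℓ) zero    ()
  enumerate (suc ℓ) (suc n) x = enumerate-last ℓ n (suc n ℕ.≤? α ℓ) (splitAt (#Ω q (suc ℓ) n α) x)

  enumerate-last ℓ n _          (inj₁ y) = skip (enumerate (suc ℓ) n y)
  enumerate-last ℓ n (yes fits) (inj₂ z) = newPivot ℓ n fits (remQuot (q ℕ.^ (n ℕ.∸ ℓ)) z)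
  enumerate-last ℓ n (no _)     (inj₂ ())

  newPivot ℓ n fits (y , r) = pivot fits (enumerate ℓ n y) (offPivot (enumerate ℓ n y) r) (offPivot-vanishes (enumerate ℓ n y) r)

  enumerate-injective : ∀ ℓ n {x x′} → enumerate ℓ n x ≈ᴱ enumerate ℓ n x′ → x ≡ x′
  enumerate-last-injective : ∀ ℓ n fits? {s s′} → enumerate-last ℓ n fits? s ≈ᴱ enumerate-last ℓ n fits? s′ → s ≡ s′

  enumerate-injective zero    n       {zero} {zero} _ = ≡.refl
  enumerate-injective (suc ℓ) (suc n) {x} {x′} eq =
    ≡.trans (≡.sym (join-splitAt m _ x))
      (≡.trans (≡.cong (join m _) (enumerate-last-injective ℓ n (suc n ℕ.≤? α ℓ) {splitAt m x} {splitAt m x′} eq)) (join-splitAt m _ x′))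
    where m = #Ω q (suc ℓ) n α

  enumerate-last-injective ℓ n _          {inj₁ y} {inj₁ y′} eq = ≡.cong inj₁ (enumerate-injective (suc ℓ) n eq)
  enumerate-last-injective ℓ n (yes _)    {inj₁ _} {inj₂ _}  ()
  enumerate-last-injective ℓ n (yes _)    {inj₂ _} {inj₁ _}  ()
  enumerate-last-injective ℓ n (yes fits) {inj₂ z} {inj₂ z′} eq =
    ≡.cong inj₂ (remQuot-injective {#Ω q ℓ n α} (q ℕ.^ (n ℕ.∸ ℓ)) (newPivot-injective eq))
    where
    newPivot-injective : ∀ {p p′} → newPivot ℓ n fits p ≈ᴱ newPivot ℓ n fits p′ → p ≡ p′
    newPivot-injective {y , r} {y′ , r′} (e≈ , c≋) with enumerate-injective ℓ n e≈
    ... | ≡.refl = ≡.cong (y ,_) (offPivot-injective (enumerate ℓ n y) c≋)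

  enumerate-surjective : ∀ ℓ n (e : Echelon ℓ n) → ∃ λ x → enumerate ℓ n x ≈ᴱ e
  enumerate-last-surjective : ∀ ℓ n fits? (e : Echelon (suc ℓ) (suc n)) → ∃ λ s → enumerate-last ℓ n fits? s ≈ᴱ e

  enumerate-surjective zero    n       [] = zero , tt
  enumerate-surjective (suc ℓ) (suc n) e with enumerate-last-surjective ℓ n (suc n ℕ.≤? α ℓ) e
  ... | s , s≈e = join m _ s , ≡.subst (λ s → enumerate-last ℓ n (suc n ℕ.≤? α ℓ) s ≈ᴱ e) (≡.sym (splitAt-join m _ s)) s≈e
    where m = #Ω q (suc ℓ) n α

  enumerate-last-surjective ℓ n _ (skip e) with enumerate-surjective (suc ℓ) n e
  ... | y , y≈e = inj₁ y , y≈e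
  enumerate-last-surjective ℓ n (no ¬fits) (pivot fits _ _ _) = ⊥-elim (¬fits fits)
  enumerate-last-surjective ℓ n (yes fits′) (pivot fits e c c-red) with enumerate-surjective ℓ n e
  ... | y , y≈e with offPivot-surjective (enumerate ℓ n y) c (λ j pj → c-red j (isPivot-cong (enumerate ℓ n y) e y≈e j pj))
  ...   | r , r≋c = inj₂ (combine y r) ,
    ≡.subst (λ p → newPivot ℓ n fits′ p ≈ᴱ pivot fits e c c-red) (≡.sym (remQuot-combine y r)) (y≈e , r≋c)

  module _ {ℓ n : ℕ} (αᶠ : Fin ℓ → ℕ) (α≗αᶠ : ∀ i → α (toℕ i) ≡ αᶠ i) where

    private
      module Ω = Setoid (Schubert ℓ n αᶠ)

    toPoint : Echelon ℓ n → SchubertPoint ℓ n αᶠ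
    toPoint e = record
      { L    = span (basis e)
      ; dimL = basis e , basis-linIndep e , ∈-span (basis e) , (λ _ v∈ → v∈)
      ; cond = λ i → ≡.subst (λ t → DimCapAtLeast (span (basis e)) t (suc (toℕ i))) (α≗αᶠ i) (basis-conditions e i)
      }

    toPoint-injective : ∀ {e e′} → toPoint e Ω.≈ toPoint e′ → e ≈ᴱ e′
    toPoint-injective {e} {e′} e≈e′ =
      span-injective e e′ (λ i → proj₁ (e≈e′ (basis e i)) (∈-span (basis e) i)) (λ i → proj₂ (e≈e′ (basis e′ i)) (∈-span (basis e′) i))

    toPoint-surjective : ∀ P → ∃ λ e → toPoint e Ω.≈ P
    toPoint-surjective P = e , (λ v → InSpan⇒member L (λ i → InSpan⇒member L b∈L (e⊑b i)) , (λ v∈L → span-⊆ b⊑e (b-spans v v∈L)))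
      where
      open SchubertPoint P
      b = proj₁ dimL
      b∈L = proj₁ (proj₂ (proj₂ dimL))
      b-spans = proj₂ (proj₂ (proj₂ dimL))
      conds : Conditions ℓ (span b)
      conds i with cond i
      ... | u , u-indep , u∈ =
        u , u-indep , (λ j → b-spans (u j) (proj₁ (u∈ j)) , ≡.subst (λ t → InStd t (u j)) (≡.sym (α≗αᶠ i)) (proj₂ (u∈ j)))
      echelonized = echelonize b (proj₁ (proj₂ dimL)) conds
      e = proj₁ echelonized
      e⊑b = proj₁ (proj₂ echelonized)
      b⊑e = proj₂ (proj₂ echelonized)

    toPoint-cong : ∀ {e e′} → e ≈ᴱ e′ → toPoint e Ω.≈ toPoint e′
    toPoint-cong {e} {e′} e≈e′ v =
      span-⊆ (λ i → InSpan-cong (basis-cong e e′ e≈e′) (∈-span (basis e) i)) ,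
      span-⊆ (λ i → InSpan-cong (λ i′ → sym ∘ basis-cong e e′ e≈e′ i′) (∈-span (basis e′) i))

    schubert-hasCard : HasCard (Schubert ℓ n αᶠ) (#Ω q ℓ n α)
    schubert-hasCard = record
      { to        = toPoint ∘ enumerate ℓ n
      ; cong      = λ { ≡.refl v → id , id }
      ; bijective = (λ {x} {y} eq → enumerate-injective ℓ n (toPoint-injective {enumerate ℓ n x} {enumerate ℓ n y} eq)) , surjective
      }
      where
      surjective : ∀ P → ∃ λ x → ∀ {z} → z ≡ x → toPoint (enumerate ℓ n z) Ω.≈ P
      surjective P with toPoint-surjective P
      ... | e , e≈P with enumerate-surjective ℓ n e
      ...   | x , x≈e = x , λ { ≡.refl → Ω.trans {toPoint (enumerate ℓ n x)} {toPoint e} {P} (toPoint-cong {enumerate ℓ n x} {e} x≈e) e≈P }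

-- Arithmetic of #Ω

open import Data.Nat using (_+_; _*_; _∸_; _^_; _⊓_; _≤_; _<_; _≤?_; _<?_; s≤s; z≤n)
open import Data.Nat.Properties
open import Data.Nat.Solver using (module +-*-Solver)
open +-*-Solver
open ≡ using (refl; cong; cong₂; sym; trans; subst; subst₂)

[]·-yes : ∀ {p} {P : Set p} (d : Dec P) → P → ∀ x → [ d ]· x ≡ x
[]·-yes (yes _) _ x = refl
[]·-yes (no ¬P) P x = ⊥-elim (¬P P)

[]·-no : ∀ {p} {P : Set p} (d : Dec P) → ¬ P → ∀ x → [ d ]· x ≡ 0
[]·-no (yes P) ¬P x = ⊥-elim (¬P P)
[]·-no (no _)  _  x = refl

[]·-zero : ∀ {p} {P : Set p} (d : Dec P) → [ d ]· 0 ≡ 0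
[]·-zero (yes _) = refl
[]·-zero (no _)  = refl

[]·-cong : ∀ {p p′} {P : Set p} {P′ : Set p′} (d : Dec P) (d′ : Dec P′) → (P → P′) → (P′ → P) →
           ∀ {x y} → x ≡ y → [ d ]· x ≡ [ d′ ]· y
[]·-cong (yes _) (yes _)  _ _ x≡y = x≡y
[]·-cong (yes P) (no ¬P′) f _ _   = ⊥-elim (¬P′ (f P))
[]·-cong (no ¬P) (yes P′) _ g _   = ⊥-elim (¬P (g P′))
[]·-cong (no _)  (no _)   _ _ _   = refl

module _ (q : ℕ) where

  #Ω-empty : ∀ ℓ n a → n < ℓ → #Ω q ℓ n a ≡ 0
  #Ω-empty (suc ℓ) zero    a _         = refl
  #Ω-empty (suc ℓ) (suc n) a (s≤s n<ℓ) = begin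
    #Ω q (suc ℓ) n a + [ suc n ≤? a ℓ ]· (#Ω q ℓ n a * q ^ (n ∸ ℓ))
      ≡⟨ cong₂ (λ x y → x + [ suc n ≤? a ℓ ]· (y * q ^ (n ∸ ℓ))) (#Ω-empty (suc ℓ) n a (m<n⇒m<1+n n<ℓ)) (#Ω-empty ℓ n a n<ℓ) ⟩
    [ suc n ≤? a ℓ ]· 0
      ≡⟨ []·-zero (suc n ≤? a ℓ) ⟩
    0 ∎
    where open ≡.≡-Reasoning

  -- In V_n, the condition dim (L ∩ V_x) ≥ j + 1 holds for every ℓ-dimensional L as soon as n + j + 1 ≤ x + ℓ.
  Vacuous : ℕ → ℕ → ℕ → ℕ → Set
  Vacuous n ℓ j x = n + suc j ≤ x + ℓ

  SameCondition : ℕ → ℕ → ℕ → ℕ → ℕ → Set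
  SameCondition n ℓ j x y = x ≡ y ⊎ (Vacuous n ℓ j x × Vacuous n ℓ j y)

  #Ω-cong : ∀ ℓ n a b → (∀ j → j < ℓ → SameCondition n ℓ j (a j) (b j)) → #Ω q ℓ n a ≡ #Ω q ℓ n b
  #Ω-cong zero    n       a b _   = refl
  #Ω-cong (suc ℓ) zero    a b _   = refl
  #Ω-cong (suc ℓ) (suc n) a b a~b = cong₂ _+_
    (#Ω-cong (suc ℓ) n a b (λ j j<ℓ → weaken (λ v → ≤-trans (n≤1+n _) v) (a~b j j<ℓ)))
    ([]·-cong (suc n ≤? a ℓ) (suc n ≤? b ℓ) (last⇒ (a~b ℓ ≤-refl)) (last⇒ (swap (a~b ℓ ≤-refl)))
      (cong (_* q ^ (n ∸ ℓ)) (#Ω-cong ℓ n a b (λ j j<ℓ → weaken shift (a~b j (m<n⇒m<1+n j<ℓ))))))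
    where
    weaken : ∀ {n′ ℓ′ j x y} → (∀ {z} → Vacuous (suc n) (suc ℓ) j z → Vacuous n′ ℓ′ j z) →
             SameCondition (suc n) (suc ℓ) j x y → SameCondition n′ ℓ′ j x y
    weaken f (inj₁ x≡y)       = inj₁ x≡y
    weaken f (inj₂ (x↑ , y↑)) = inj₂ (f x↑ , f y↑)
    shift : ∀ {z j} → Vacuous (suc n) (suc ℓ) j z → Vacuous n ℓ j z
    shift {z} {j} v = ≤-pred (subst (suc n + suc j ≤_) (+-suc z ℓ) v)
    swap : ∀ {x y} → SameCondition (suc n) (suc ℓ) ℓ x y → SameCondition (suc n) (suc ℓ) ℓ y x
    swap (inj₁ x≡y)       = inj₁ (sym x≡y)
    swap (inj₂ (x↑ , y↑)) = inj₂ (y↑ , x↑)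
    last⇒ : ∀ {x y} → SameCondition (suc n) (suc ℓ) ℓ x y → suc n ≤ x → suc n ≤ y
    last⇒ (inj₁ ≡.refl)   n<x = n<x
    last⇒ (inj₂ (_ , y↑)) _   = +-cancelʳ-≤ (suc ℓ) (suc n) _ y↑

  #Ω-stable : ∀ L a i → #Ω q (suc L) (a L + i) a ≡ #Ω q (suc L) (a L) a
  #Ω-stable L a zero    = cong (λ n → #Ω q (suc L) n a) (+-identityʳ (a L))
  #Ω-stable L a (suc i) = begin
    #Ω q (suc L) (a L + suc i) a
      ≡⟨ cong (λ n → #Ω q (suc L) n a) (+-suc (a L) i) ⟩
    #Ω q (suc L) (a L + i) a + [ suc (a L + i) ≤? a L ]· _
      ≡⟨ cong (#Ω q (suc L) (a L + i) a +_) ([]·-no (suc (a L + i) ≤? a L) (λ le → <-irrefl refl (≤-trans le (m≤m+n (a L) i))) _) ⟩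
    #Ω q (suc L) (a L + i) a + 0
      ≡⟨ trans (+-identityʳ _) (#Ω-stable L a i) ⟩
    #Ω q (suc L) (a L) a ∎
    where open ≡.≡-Reasoning

  -- the recursion of #Ω when the last s conditions impose nothing (see #Ω-Free)
  Free : (ℕ → ℕ) → ℕ → ℕ → ℕ
  Free h zero    N       = h N
  Free h (suc s) zero    = Free h s zero
  Free h (suc s) (suc N) = Free h (suc s) N + q ^ suc N * Free h s (suc N)

  #Ω-Free : ∀ k s N b → (∀ j → k ≤ j → j < s + k → N + (s + k) ≤ b j) →
            #Ω q (s + k) (N + (s + k)) b ≡ Free (λ N → #Ω q k (N + k) b) s N
  #Ω-Free k zero    N       b _    = refl
  #Ω-Free k (suc s) zero    b free = begin
    #Ω q (suc L) L b + [ suc L ≤? b L ]· (#Ω q L L b * q ^ (L ∸ L))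
      ≡⟨ cong₂ _+_ (#Ω-empty (suc L) L b (n<1+n L)) ([]·-yes (suc L ≤? b L) (free L (m≤n+m k s) (n<1+n L)) _) ⟩
    #Ω q L L b * q ^ (L ∸ L)
      ≡⟨ trans (cong (λ e → #Ω q L L b * q ^ e) (n∸n≡0 L)) (*-identityʳ _) ⟩
    #Ω q L L b
      ≡⟨ #Ω-Free k s zero b (λ j k≤j j<L → ≤-trans (n≤1+n L) (free j k≤j (m<n⇒m<1+n j<L))) ⟩
    Free _ s zero ∎
    where
    open ≡.≡-Reasoning
    L = s + k
  #Ω-Free k (suc s) (suc N) b free = begin
    #Ω q (suc L) (N + suc L) b + [ suc (N + suc L) ≤? b L ]· (#Ω q L (N + suc L) b * q ^ (N + suc L ∸ L))
      ≡⟨ cong₂ _+_ (#Ω-Free k (suc s) N b (λ j k≤j j<L → ≤-trans (n≤1+n _) (free j k≤j j<L)))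
                   ([]·-yes (suc (N + suc L) ≤? b L) (free L (m≤n+m k s) (n<1+n L)) _) ⟩
    Free h (suc s) N + #Ω q L (N + suc L) b * q ^ (N + suc L ∸ L)
      ≡⟨ cong (Free h (suc s) N +_) (trans (*-comm (#Ω q L (N + suc L) b) _) (cong₂ _*_ (cong (q ^_) N+1+L∸L) rest)) ⟩
    Free h (suc s) N + q ^ suc N * Free h s (suc N) ∎
    where
    open ≡.≡-Reasoning
    L = s + k
    h = λ N → #Ω q k (N + k) b
    N+1+L∸L : N + suc L ∸ L ≡ suc N
    N+1+L∸L = trans (cong (_∸ L) (+-suc N L)) (m+n∸n≡m (suc N) L)
    rest : #Ω q L (N + suc L) b ≡ Free (λ N → #Ω q k (N + k) b) s (suc N)
    rest = trans (cong (λ n → #Ω q L n b) (+-suc N L))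
                 (#Ω-Free k s (suc N) b (λ j k≤j j<L → ≤-trans (s≤s (+-monoʳ-≤ N (n≤1+n L))) (free j k≤j (m<n⇒m<1+n j<L))))

  Free-linear : ∀ (h h₀ ε : ℕ → ℕ) A → (∀ n → h n ≡ A * h₀ n + ε n) → ∀ s N → Free h s N ≡ A * Free h₀ s N + Free ε s N
  Free-linear h h₀ ε A h≡ zero    N       = h≡ N
  Free-linear h h₀ ε A h≡ (suc s) zero    = Free-linear h h₀ ε A h≡ s zero
  Free-linear h h₀ ε A h≡ (suc s) (suc N) = begin
    Free h (suc s) N + q ^ suc N * Free h s (suc N)
      ≡⟨ cong₂ (λ x y → x + q ^ suc N * y) (Free-linear h h₀ ε A h≡ (suc s) N) (Free-linear h h₀ ε A h≡ s (suc N)) ⟩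
    (A * Free h₀ (suc s) N + Free ε (suc s) N) + q ^ suc N * (A * Free h₀ s (suc N) + Free ε s (suc N))
      ≡⟨ solve 6 (λ A x y Q z w → (A :* x :+ y) :+ Q :* (A :* z :+ w) := A :* (x :+ Q :* z) :+ (y :+ Q :* w)) refl
               A (Free h₀ (suc s) N) (Free ε (suc s) N) (q ^ suc N) (Free h₀ s (suc N)) (Free ε s (suc N)) ⟩
    A * Free h₀ (suc s) (suc N) + Free ε (suc s) (suc N) ∎
    where open ≡.≡-Reasoning

  Free-cong : ∀ {h h′ : ℕ → ℕ} → (∀ N → h N ≡ h′ N) → ∀ s N → Free h s N ≡ Free h′ s N
  Free-cong h≗h′ zero    N       = h≗h′ N
  Free-cong h≗h′ (suc s) zero    = Free-cong h≗h′ s zero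
  Free-cong h≗h′ (suc s) (suc N) = cong₂ (λ x y → x + q ^ suc N * y) (Free-cong h≗h′ (suc s) N) (Free-cong h≗h′ s (suc N))

  -- the Gaussian binomial coefficient [M + s choose s]_q
  binom : ℕ → ℕ → ℕ
  binom = Free (λ _ → 1)

  binom-zero : ∀ s → binom s 0 ≡ 1
  binom-zero zero    = refl
  binom-zero (suc s) = binom-zero s

  binom-pascal : ∀ s M → binom (suc s) (suc M) ≡ q ^ suc s * binom (suc s) M + binom s (suc M)
  binom-pascal zero M = pascal₁ M
    where
    pascal₁ : ∀ M → binom 1 (suc M) ≡ q ^ 1 * binom 1 M + 1
    pascal₁ zero    = solve 1 (λ q → con 1 :+ q :* con 1 :* con 1 := q :* con 1 :* con 1 :+ con 1) refl q
    pascal₁ (suc M) = begin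
      binom 1 (suc M) + q ^ suc (suc M) * 1   ≡⟨ cong (_+ q ^ suc (suc M) * 1) (pascal₁ M) ⟩
      (q ^ 1 * binom 1 M + 1) + q * q ^ suc M * 1
        ≡⟨ solve 3 (λ q r x → (q :* con 1 :* r :+ con 1) :+ q :* x :* con 1 := q :* con 1 :* (r :+ x :* con 1) :+ con 1) refl q (binom 1 M) (q ^ suc M) ⟩
      q ^ 1 * binom 1 (suc M) + 1 ∎
      where open ≡.≡-Reasoning
  binom-pascal (suc s) zero = begin
    binom (suc (suc s)) 0 + q ^ 1 * binom (suc s) 1   ≡⟨ cong₂ _+_ (binom-zero s) (cong (_* binom (suc s) 1) (*-identityʳ q)) ⟩
    1 + q * binom (suc s) 1                           ≡⟨ top (suc s) ⟩
    q ^ suc (suc s) + binom (suc s) 1                 ≡⟨ cong (_+ binom (suc s) 1) (trans (sym (*-identityʳ (q ^ suc (suc s))))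
                                                                                          (cong (q ^ suc (suc s) *_) (sym (binom-zero s)))) ⟩
    q ^ suc (suc s) * binom (suc (suc s)) 0 + binom (suc s) 1 ∎
    where
    open ≡.≡-Reasoning
    top : ∀ s → 1 + q * binom s 1 ≡ q ^ suc s + binom s 1
    top zero    = solve 1 (λ q → con 1 :+ q :* con 1 := q :* con 1 :+ con 1) refl q
    top (suc s) = begin
      1 + q * (binom s 0 + q * 1 * binom s 1)   ≡⟨ cong (λ z → 1 + q * (z + q * 1 * binom s 1)) (binom-zero s) ⟩
      1 + q * (1 + q * 1 * binom s 1)           ≡⟨ cong (λ z → 1 + q * (1 + z)) (cong (_* binom s 1) (*-identityʳ q)) ⟩
      1 + q * (1 + q * binom s 1)               ≡⟨ cong (λ z → 1 + q * z) (top s) ⟩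
      1 + q * (q ^ suc s + binom s 1)
        ≡⟨ solve 3 (λ q y x → con 1 :+ q :* (y :+ x) := q :* y :+ (con 1 :+ q :* con 1 :* x)) refl q (q ^ suc s) (binom s 1) ⟩
      q * q ^ suc s + (1 + q * 1 * binom s 1)   ≡⟨ cong (λ z → q * q ^ suc s + (z + q * 1 * binom s 1)) (sym (binom-zero s)) ⟩
      q ^ suc (suc s) + binom (suc s) 1 ∎
  binom-pascal (suc s) (suc M) = begin
    binom (suc (suc s)) (suc M) + q ^ suc (suc M) * binom (suc s) (suc (suc M))
      ≡⟨ cong₂ (λ x y → x + q ^ suc (suc M) * y) (binom-pascal (suc s) M) (binom-pascal s (suc M)) ⟩
    (q ^ suc (suc s) * binom (suc (suc s)) M + binom (suc s) (suc M)) + q ^ suc (suc M) * (q ^ suc s * binom (suc s) (suc M) + binom s (suc (suc M)))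
      ≡⟨ solve 6 (λ q x y a b c → (q :* x :* a :+ b) :+ q :* y :* (x :* b :+ c) := q :* x :* (a :+ y :* b) :+ (b :+ q :* y :* c))
               refl q (q ^ suc s) (q ^ suc M) (binom (suc (suc s)) M) (binom (suc s) (suc M)) (binom s (suc (suc M))) ⟩
    q ^ suc (suc s) * binom (suc (suc s)) (suc M) + binom (suc s) (suc (suc M)) ∎
    where open ≡.≡-Reasoning

  atLeast : ℕ → ℕ → ℕ
  atLeast d N = [ d ≤? N ]· 1

  Free-atLeast-below : ∀ d s N → N < d → Free (atLeast d) s N ≡ 0
  Free-atLeast-below d zero    N       N<d = []·-no (d ≤? N) (<⇒≱ N<d) 1
  Free-atLeast-below d (suc s) zero    N<d = Free-atLeast-below d s zero N<d
  Free-atLeast-below d (suc s) (suc N) N<d =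
    trans (cong₂ (λ x y → x + q ^ suc N * y) (Free-atLeast-below d (suc s) N (<-trans (n<1+n N) N<d)) (Free-atLeast-below d s (suc N) N<d))
          (*-zeroʳ (q ^ suc N))

  Free-atLeast : ∀ d s M → Free (atLeast d) s (d + M) ≡ q ^ (s * d) * binom s M
  Free-atLeast d zero M = trans ([]·-yes (d ≤? d + M) (m≤m+n d M) 1) (sym (*-identityˡ 1))
  Free-atLeast zero (suc s) zero = Free-atLeast zero s zero
  Free-atLeast (suc d) (suc s) zero = begin
    Free (atLeast (suc d)) (suc s) (suc d + 0)
      ≡⟨ cong (Free (atLeast (suc d)) (suc s)) (+-identityʳ (suc d)) ⟩
    Free (atLeast (suc d)) (suc s) d + q ^ suc d * Free (atLeast (suc d)) s (suc d)
      ≡⟨ cong₂ (λ x y → x + q ^ suc d * y) (Free-atLeast-below (suc d) (suc s) d (n<1+n d))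
               (trans (cong (Free (atLeast (suc d)) s) (sym (+-identityʳ (suc d)))) (Free-atLeast (suc d) s zero)) ⟩
    0 + q ^ suc d * (q ^ (s * suc d) * binom s 0)
      ≡⟨ trans (sym (*-assoc (q ^ suc d) _ _)) (cong (_* binom s 0) (sym (^-distribˡ-+-* q (suc d) (s * suc d)))) ⟩
    q ^ (suc s * suc d) * binom (suc s) 0 ∎
    where open ≡.≡-Reasoning
  Free-atLeast d (suc s) (suc M) = begin
    Free (atLeast d) (suc s) (d + suc M)
      ≡⟨ cong (Free (atLeast d) (suc s)) (+-suc d M) ⟩
    Free (atLeast d) (suc s) (d + M) + q ^ suc (d + M) * Free (atLeast d) s (suc (d + M))
      ≡⟨ cong₂ (λ x y → x + q ^ suc (d + M) * y) (Free-atLeast d (suc s) M)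
               (trans (cong (Free (atLeast d) s) (sym (+-suc d M))) (Free-atLeast d s (suc M))) ⟩
    q ^ (d + s * d) * binom (suc s) M + q ^ suc (d + M) * (q ^ (s * d) * binom s (suc M))
      ≡⟨ cong₂ (λ x y → x * binom (suc s) M + y * (q ^ (s * d) * binom s (suc M)))
               (^-distribˡ-+-* q d (s * d)) (trans (cong (q ^_) (sym (+-suc d M))) (^-distribˡ-+-* q d (suc M))) ⟩
    q ^ d * q ^ (s * d) * binom (suc s) M + q ^ d * q ^ suc M * (q ^ (s * d) * binom s (suc M))
      ≡⟨ solve 5 (λ a b c e f → a :* b :* c :+ a :* e :* (b :* f) := (a :* b) :* (c :+ e :* f)) refl
               (q ^ d) (q ^ (s * d)) (binom (suc s) M) (q ^ suc M) (binom s (suc M)) ⟩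
    q ^ d * q ^ (s * d) * binom (suc s) (suc M)
      ≡⟨ cong (_* binom (suc s) (suc M)) (sym (^-distribˡ-+-* q d (s * d))) ⟩
    q ^ (suc s * d) * binom (suc s) (suc M) ∎
    where open ≡.≡-Reasoning

-- δ of a 0-based sequence, summed termwise; it agrees with δ when every a j exceeds j (see δ≡δ̂)
δ̂ : (ℕ → ℕ) → ℕ → ℕ
δ̂ a zero    = 0
δ̂ a (suc L) = δ̂ a L + (a L ∸ suc L)

δ̂-cong : ∀ {x y : ℕ → ℕ} L → (∀ j → j < L → x j ≡ y j) → δ̂ x L ≡ δ̂ y L
δ̂-cong zero    _   = refl
δ̂-cong (suc L) x≡y = cong₂ (λ A B → A + (B ∸ suc L)) (δ̂-cong L (λ j j<L → x≡y j (m<n⇒m<1+n j<L))) (x≡y L (n<1+n L))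

δ̂-block : ∀ (c : ℕ → ℕ) k v i → (∀ j → k ≤ j → j < i + k → c j ∸ suc j ≡ v) → δ̂ c (i + k) ≡ δ̂ c k + i * v
δ̂-block c k v zero    _     = sym (+-identityʳ _)
δ̂-block c k v (suc i) c≡v = begin
  δ̂ c (i + k) + (c (i + k) ∸ suc (i + k))   ≡⟨ cong₂ _+_ (δ̂-block c k v i (λ j k≤j j<i+k → c≡v j k≤j (m<n⇒m<1+n j<i+k)))
                                                         (c≡v (i + k) (m≤n+m k i) (n<1+n (i + k))) ⟩
  δ̂ c k + i * v + v                         ≡⟨ trans (+-assoc (δ̂ c k) (i * v) v) (cong (δ̂ c k +_) (+-comm (i * v) v)) ⟩
  δ̂ c k + suc i * v                         ∎
  where open ≡.≡-Reasoning

^-distribʳ-* : ∀ a b s → (a * b) ^ s ≡ a ^ s * b ^ s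
^-distribʳ-* a b zero    = refl
^-distribʳ-* a b (suc s) = trans (cong ((a * b) *_) (^-distribʳ-* a b s))
                                 (solve 4 (λ a b x y → (a :* b) :* (x :* y) := (a :* x) :* (b :* y)) refl a b (a ^ s) (b ^ s))

module Bounds (p : ℕ) where

  q : ℕ
  q = suc p

  #Ω-bound-step : ∀ L a X → (∀ n → p ^ L * #Ω q L n a ≤ X) → ∀ i → i ≤ a L → p ^ suc L * #Ω q (suc L) i a + X ≤ X * q ^ (i ∸ L)
  #Ω-bound-step L a X bound zero _ =
    ≤-reflexive (trans (cong (_+ X) (*-zeroʳ (p ^ suc L))) (sym (trans (cong (λ e → X * q ^ e) (0∸n≡0 L)) (*-identityʳ X))))
  #Ω-bound-step L a X bound (suc i) i<aL with L ≤? i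
  ... | yes L≤i = begin
    p ^ suc L * (#Ω q (suc L) i a + [ suc i ≤? a L ]· (#Ω q L i a * q ^ (i ∸ L))) + X
      ≡⟨ cong (λ c → p ^ suc L * (#Ω q (suc L) i a + c) + X) ([]·-yes (suc i ≤? a L) i<aL _) ⟩
    p ^ suc L * (#Ω q (suc L) i a + #Ω q L i a * q ^ (i ∸ L)) + X
      ≡⟨ solve 6 (λ p pL C D Q X → (p :* pL) :* (C :+ D :* Q) :+ X := ((p :* pL) :* C :+ X) :+ p :* Q :* (pL :* D)) refl
               p (p ^ L) (#Ω q (suc L) i a) (#Ω q L i a) (q ^ (i ∸ L)) X ⟩
    (p ^ suc L * #Ω q (suc L) i a + X) + p * q ^ (i ∸ L) * (p ^ L * #Ω q L i a)
      ≤⟨ +-mono-≤ (#Ω-bound-step L a X bound i (≤-trans (n≤1+n i) i<aL)) (*-monoʳ-≤ (p * q ^ (i ∸ L)) (bound i)) ⟩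
    X * q ^ (i ∸ L) + p * q ^ (i ∸ L) * X
      ≡⟨ solve 3 (λ X Q p → X :* Q :+ p :* Q :* X := X :* ((con 1 :+ p) :* Q)) refl X (q ^ (i ∸ L)) p ⟩
    X * (q * q ^ (i ∸ L))
      ≡⟨ cong (λ e → X * q ^ e) (sym (+-∸-assoc 1 L≤i)) ⟩
    X * q ^ (suc i ∸ L) ∎
    where open ≤-Reasoning
  ... | no L≰i = begin
    p ^ suc L * #Ω q (suc L) (suc i) a + X  ≡⟨ cong (λ c → p ^ suc L * c + X) (#Ω-empty q (suc L) (suc i) a (s≤s (≰⇒> L≰i))) ⟩
    p ^ suc L * 0 + X                       ≡⟨ cong (_+ X) (*-zeroʳ (p ^ suc L)) ⟩
    X                                       ≤⟨ m≤m*n X (q ^ (suc i ∸ L)) {{m^n≢0 q (suc i ∸ L)}} ⟩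
    X * q ^ (suc i ∸ L)                     ∎
    where open ≤-Reasoning

  #Ω-bound : ∀ L a → (∀ j → j < L → suc j ≤ a j) → ∀ n → p ^ L * #Ω q L n a ≤ q ^ (L + δ̂ a L)
  #Ω-bound zero    a _  n = ≤-refl
  #Ω-bound (suc L) a a≥ n = ≤-trans (capped n) (≤-reflexive X*q^[aL∸L]≡)
    where
    X = q ^ (L + δ̂ a L)
    grow = #Ω-bound-step L a X (#Ω-bound L a (λ j j<L → a≥ j (m<n⇒m<1+n j<L)))
    below : ∀ i → i ≤ a L → p ^ suc L * #Ω q (suc L) i a ≤ X * q ^ (a L ∸ L)
    below i i≤aL = ≤-trans (m+n≤o⇒m≤o _ (grow i i≤aL)) (*-monoʳ-≤ X (^-monoʳ-≤ q (∸-monoˡ-≤ L i≤aL)))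
    capped : ∀ n → p ^ suc L * #Ω q (suc L) n a ≤ X * q ^ (a L ∸ L)
    capped n with n ≤? a L
    ... | yes n≤aL = below n n≤aL
    ... | no  n≰aL = subst (λ c → p ^ suc L * c ≤ X * q ^ (a L ∸ L))
                       (trans (sym (#Ω-stable q L a (n ∸ a L))) (cong (λ x → #Ω q (suc L) x a) (m+[n∸m]≡n (<⇒≤ (≰⇒> n≰aL)))))
                       (below (a L) ≤-refl)
    X*q^[aL∸L]≡ : X * q ^ (a L ∸ L) ≡ q ^ (suc L + δ̂ a (suc L))
    X*q^[aL∸L]≡ = begin
      q ^ (L + δ̂ a L) * q ^ (a L ∸ L)          ≡⟨ sym (^-distribˡ-+-* q (L + δ̂ a L) (a L ∸ L)) ⟩
      q ^ (L + δ̂ a L + (a L ∸ L))              ≡⟨ cong (λ e → q ^ (L + δ̂ a L + e)) (∸-suc (a≥ L (n<1+n L))) ⟩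
      q ^ (L + δ̂ a L + suc (a L ∸ suc L))      ≡⟨ cong (q ^_) (solve 3 (λ x y z → x :+ y :+ (con 1 :+ z) := con 1 :+ x :+ (y :+ z)) refl
                                                                   L (δ̂ a L) (a L ∸ suc L)) ⟩
      q ^ (suc L + δ̂ a (suc L))                ∎
      where open ≡.≡-Reasoning

  weightedSum : (ℕ → ℕ) → ℕ → ℕ
  weightedSum ε zero    = 0
  weightedSum ε (suc N) = weightedSum ε N + q ^ N * ε N

  Free-one : ∀ ε N → Free q ε 1 N ≡ weightedSum ε (suc N)
  Free-one ε zero    = sym (*-identityˡ (ε 0))
  Free-one ε (suc N) = cong (_+ q ^ suc N * ε (suc N)) (Free-one ε N)

  -- 1 + p (p + 2) = q²
  weightedSum-bound : ∀ ε d c X → (∀ j → j < d → c * ε j ≤ X * q ^ j) → (∀ j → d ≤ j → ε j ≡ 0) →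
                      ∀ N → c * (p * (p + 2)) * weightedSum ε N + X ≤ X * (q * q) ^ (N ⊓ d)
  weightedSum-bound ε d c X small vanish zero = ≤-reflexive (trans (cong (_+ X) (*-zeroʳ (c * (p * (p + 2))))) (sym (*-identityʳ X)))
  weightedSum-bound ε d c X small vanish (suc N) with N <? d
  ... | yes N<d = begin
    K * (weightedSum ε N + q ^ N * ε N) + X
      ≡⟨ solve 6 (λ c pp S Q e X → c :* pp :* (S :+ Q :* e) :+ X := (c :* pp :* S :+ X) :+ Q :* pp :* (c :* e)) refl
               c (p * (p + 2)) (weightedSum ε N) (q ^ N) (ε N) X ⟩
    (K * weightedSum ε N + X) + q ^ N * (p * (p + 2)) * (c * ε N)
      ≤⟨ +-mono-≤ (weightedSum-bound ε d c X small vanish N) (*-monoʳ-≤ (q ^ N * (p * (p + 2))) (small N N<d)) ⟩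
    X * (q * q) ^ (N ⊓ d) + q ^ N * (p * (p + 2)) * (X * q ^ N)
      ≡⟨ cong (λ z → X * z + q ^ N * (p * (p + 2)) * (X * q ^ N))
              (trans (cong ((q * q) ^_) (m≤n⇒m⊓n≡m (<⇒≤ N<d))) (^-distribʳ-* q q N)) ⟩
    X * (q ^ N * q ^ N) + q ^ N * (p * (p + 2)) * (X * q ^ N)
      ≡⟨ solve 3 (λ X Q p → X :* (Q :* Q) :+ Q :* (p :* (p :+ con 2)) :* (X :* Q) := X :* (((con 1 :+ p) :* (con 1 :+ p)) :* (Q :* Q))) refl X (q ^ N) p ⟩
    X * ((q * q) * (q ^ N * q ^ N))
      ≡⟨ cong (λ z → X * ((q * q) * z)) (sym (^-distribʳ-* q q N)) ⟩
    X * (q * q) ^ suc N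
      ≡⟨ cong (λ e → X * (q * q) ^ e) (sym (m≤n⇒m⊓n≡m N<d)) ⟩
    X * (q * q) ^ (suc N ⊓ d) ∎
    where
    open ≤-Reasoning
    K = c * (p * (p + 2))
  ... | no N≮d = begin
    K * (weightedSum ε N + q ^ N * ε N) + X
      ≡⟨ cong (λ z → K * (weightedSum ε N + q ^ N * z) + X) (vanish N (≮⇒≥ N≮d)) ⟩
    K * (weightedSum ε N + q ^ N * 0) + X
      ≡⟨ cong (λ z → K * z + X) (trans (cong (weightedSum ε N +_) (*-zeroʳ (q ^ N))) (+-identityʳ _)) ⟩
    K * weightedSum ε N + X
      ≤⟨ weightedSum-bound ε d c X small vanish N ⟩
    X * (q * q) ^ (N ⊓ d)
      ≡⟨ cong (λ e → X * (q * q) ^ e) (trans (m≥n⇒m⊓n≡n (≮⇒≥ N≮d)) (sym (m≥n⇒m⊓n≡n (m≤n⇒m≤1+n (≮⇒≥ N≮d))))) ⟩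
    X * (q * q) ^ (suc N ⊓ d) ∎
    where
    open ≤-Reasoning
    K = c * (p * (p + 2))

  Free-one-bound : ∀ ε d c X → (∀ j → j < d → c * ε j ≤ X * q ^ j) → (∀ j → d ≤ j → ε j ≡ 0) →
                   ∀ N → c * (p * (p + 2)) * Free q ε 1 N ≤ X * (q * q) ^ d
  Free-one-bound ε d c X small vanish N = begin
    c * (p * (p + 2)) * Free q ε 1 N             ≡⟨ cong (c * (p * (p + 2)) *_) (Free-one ε N) ⟩
    c * (p * (p + 2)) * weightedSum ε (suc N)    ≤⟨ m+n≤o⇒m≤o _ (weightedSum-bound ε d c X small vanish (suc N)) ⟩
    X * (q * q) ^ (suc N ⊓ d)                    ≤⟨ *-monoʳ-≤ X (^-monoʳ-≤ (q * q) (m⊓n≤n (suc N) d)) ⟩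
    X * (q * q) ^ d                              ∎
    where open ≤-Reasoning

  Free-bound : ∀ ε K B → (∀ N → K * Free q ε 1 N ≤ B) → ∀ s N → K * p ^ s * Free q ε (suc s) N ≤ B * q ^ s * (q ^ N) ^ s
  Free-bound ε K B base zero N = begin
    K * 1 * Free q ε 1 N   ≡⟨ cong (_* Free q ε 1 N) (*-identityʳ K) ⟩
    K * Free q ε 1 N       ≤⟨ base N ⟩
    B                      ≡⟨ sym (trans (*-identityʳ (B * 1)) (*-identityʳ B)) ⟩
    B * 1 * 1              ∎
    where open ≤-Reasoning
  Free-bound ε K B base (suc s) zero = begin
    K * p ^ suc s * Free q ε (suc s) 0
      ≡⟨ solve 4 (λ K p x r → K :* (p :* x) :* r := p :* (K :* x :* r)) refl K p (p ^ s) (Free q ε (suc s) 0) ⟩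
    p * (K * p ^ s * Free q ε (suc s) 0)
      ≤⟨ *-mono-≤ (n≤1+n p) (Free-bound ε K B base s zero) ⟩
    q * (B * q ^ s * (q ^ 0) ^ s)
      ≡⟨ cong (λ z → q * (B * q ^ s * z)) (^-zeroˡ s) ⟩
    q * (B * q ^ s * 1)
      ≡⟨ solve 3 (λ q B x → q :* (B :* x :* con 1) := B :* (q :* x) :* con 1) refl q B (q ^ s) ⟩
    B * q ^ suc s * 1
      ≡⟨ cong (B * q ^ suc s *_) (sym (^-zeroˡ (suc s))) ⟩
    B * q ^ suc s * (q ^ 0) ^ suc s ∎
    where open ≤-Reasoning
  Free-bound ε K B base (suc s) (suc N) = begin
    K * p ^ suc s * (Free q ε (suc (suc s)) N + q ^ suc N * Free q ε (suc s) (suc N))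
      ≡⟨ solve 6 (λ K p x a Q b → K :* (p :* x) :* (a :+ Q :* b) := K :* (p :* x) :* a :+ p :* Q :* (K :* x :* b)) refl
               K p (p ^ s) (Free q ε (suc (suc s)) N) (q ^ suc N) (Free q ε (suc s) (suc N)) ⟩
    K * p ^ suc s * Free q ε (suc (suc s)) N + p * q ^ suc N * (K * p ^ s * Free q ε (suc s) (suc N))
      ≤⟨ +-mono-≤ (Free-bound ε K B base (suc s) N) (*-monoʳ-≤ (p * q ^ suc N) (Free-bound ε K B base s (suc N))) ⟩
    B * q ^ suc s * (q ^ N) ^ suc s + p * q ^ suc N * (B * q ^ s * (q ^ suc N) ^ s)
      ≡⟨ cong (λ z → B * q ^ suc s * (q ^ N) ^ suc s + p * q ^ suc N * (B * q ^ s * z)) (^-distribʳ-* q (q ^ N) s) ⟩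
    B * q ^ suc s * (q ^ N) ^ suc s + p * q ^ suc N * (B * q ^ s * (q ^ s * (q ^ N) ^ s))
      ≡⟨ solve 6 (λ B q x Y QN p → B :* (q :* x) :* (QN :* Y) :+ p :* (q :* QN) :* (B :* x :* (x :* Y))
                                 := (B :* q :* x :* QN :* Y) :* con 1 :+ (B :* q :* x :* QN :* Y) :* (p :* x)) refl
               B q (q ^ s) ((q ^ N) ^ s) (q ^ N) p ⟩
    Z * 1 + Z * (p * q ^ s)
      ≤⟨ +-monoˡ-≤ (Z * (p * q ^ s)) (*-monoʳ-≤ Z (m^n>0 q s)) ⟩
    Z * q ^ s + Z * (p * q ^ s)
      ≡⟨ solve 5 (λ B p x QN Y → (B :* (con 1 :+ p) :* x :* QN :* Y) :* x :+ (B :* (con 1 :+ p) :* x :* QN :* Y) :* (p :* x)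
                              := B :* ((con 1 :+ p) :* x) :* (((con 1 :+ p) :* QN) :* (x :* Y))) refl
               B p (q ^ s) (q ^ N) ((q ^ N) ^ s) ⟩
    B * q ^ suc s * (q ^ suc N * (q ^ s * (q ^ N) ^ s))
      ≡⟨ cong (λ z → B * q ^ suc s * (q ^ suc N * z)) (sym (^-distribʳ-* q (q ^ N) s)) ⟩
    B * q ^ suc s * (q ^ suc N) ^ suc s ∎
    where
    open ≤-Reasoning
    Z = B * q * q ^ s * q ^ N * (q ^ N) ^ s

-- The inequality for sequences ending in a consecutive block

-- The main terms A X of both sides agree exactly, so only the error terms Y remain to be compared.
cancellation : ∀ A X₂ X₃ Y₂ Y₃ G T U E → G * U * X₃ + G * X₂ ≡ G * T * X₂ + U * X₃ → G * Y₂ < E → 2 ≤ T → 1 ≤ G →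
               G * T * (A * X₂ + Y₂) + E + U * (A * X₃ + Y₃) < G * ((A * X₂ + Y₂) + (A * X₃ + Y₃) * U) + E * T
cancellation A X₂ X₃ Y₂ Y₃ G@(suc _) (suc (suc T″)) U E main-terms small (s≤s (s≤s z≤n)) (s≤s z≤n) = begin-strict
  G * T * (A * X₂ + Y₂) + E + U * (A * X₃ + Y₃)
    ≡⟨ solve 9 (λ A X₂ X₃ Y₂ Y₃ G T′ U E → G :* (con 1 :+ T′) :* (A :* X₂ :+ Y₂) :+ E :+ U :* (A :* X₃ :+ Y₃)
               := A :* (G :* (con 1 :+ T′) :* X₂ :+ U :* X₃) :+ (T′ :* (G :* Y₂) :+ (G :* Y₂ :+ E :+ U :* Y₃))) refl
             A X₂ X₃ Y₂ Y₃ G T′ U E ⟩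
  A * (G * T * X₂ + U * X₃) + (T′ * (G * Y₂) + (G * Y₂ + E + U * Y₃))
    ≡⟨ cong (λ z → A * z + (T′ * (G * Y₂) + (G * Y₂ + E + U * Y₃))) (sym main-terms) ⟩
  A * (G * U * X₃ + G * X₂) + (T′ * (G * Y₂) + (G * Y₂ + E + U * Y₃))
    <⟨ +-monoʳ-< (A * (G * U * X₃ + G * X₂)) (+-mono-<-≤ (*-monoʳ-< T′ small) (+-monoʳ-≤ (G * Y₂ + E) (m≤n*m (U * Y₃) G))) ⟩
  A * (G * U * X₃ + G * X₂) + (T′ * E + (G * Y₂ + E + G * (U * Y₃)))
    ≡⟨ solve 9 (λ A X₂ X₃ Y₂ Y₃ G T′ U E → A :* (G :* U :* X₃ :+ G :* X₂) :+ (T′ :* E :+ (G :* Y₂ :+ E :+ G :* (U :* Y₃)))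
               := G :* ((A :* X₂ :+ Y₂) :+ (A :* X₃ :+ Y₃) :* U) :+ E :* (con 1 :+ T′)) refl
             A X₂ X₃ Y₂ Y₃ G T′ U E ⟩
  G * ((A * X₂ + Y₂) + (A * X₃ + Y₃) * U) + E * T ∎
  where
  open ≤-Reasoning
  T′ = suc T″
  T = suc T′

-- a = (a 0, …, a (ℓ - 1)) with a (k - 1) = d + k, followed by a jump of g + 1 ≥ 2 into the consecutive block
-- a j = u + j + 1 (k ≤ j < ℓ, u = g + d) ending at m = u + ℓ; a′ lowers the block by one.
module BlockShape (p k′ d g′ s : ℕ) (a a′ : ℕ → ℕ)
  (a-head : ∀ j → j < k′ → suc j ≤ a j) (a-gap : a k′ ≡ d + suc k′)
  (a-block : ∀ j → suc k′ ≤ j → j < suc s + suc k′ → a j ≡ suc g′ + d + suc j)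
  (a′-head : ∀ j → j < suc k′ → a′ j ≡ a j) (a′-block : ∀ j → suc k′ ≤ j → j < suc s + suc k′ → suc (a′ j) ≡ a j)
  (q-large : suc p * suc p ^ (s + suc k′) < p ^ (s + suc k′) * (p * (p + 2))) where

  open Bounds p

  k ℓ g u m M′ : ℕ
  k  = suc k′
  ℓ  = suc s + k
  g  = suc g′
  u  = g + d
  m  = u + ℓ
  M′ = g′ + d + ℓ

  x+[1+y]∸y : ∀ x y → x + suc y ∸ y ≡ suc x
  x+[1+y]∸y x y = trans (cong (_∸ y) (+-suc x y)) (m+n∸n≡m (suc x) y)

  #Ω-peel : #Ω q ℓ m a ≡ #Ω q ℓ M′ a + #Ω q (s + k) M′ a * q ^ u
  #Ω-peel = cong (#Ω q ℓ M′ a +_) (trans ([]·-yes (suc M′ ≤? a (s + k)) (≤-reflexive (sym (a-block (s + k) (m≤n+m k s) ≤-refl))) _)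
                                         (cong (λ e → #Ω q (s + k) M′ a * q ^ e) (x+[1+y]∸y (g′ + d) (s + k))))

  a-block′ : ∀ j → k ≤ j → j < ℓ → a j + ℓ ≡ suc (M′ + suc j)
  a-block′ j k≤j j<ℓ = trans (cong (_+ ℓ) (a-block j k≤j j<ℓ))
    (solve 4 (λ g′ d j ℓ → (con 1 :+ g′ :+ d :+ (con 1 :+ j)) :+ ℓ := con 1 :+ (g′ :+ d :+ ℓ :+ (con 1 :+ j))) refl g′ d j ℓ)

  -- in V_{m-1} the block conditions are vacuous, so a, a′ and b count the same subspaces
  b : ℕ → ℕ
  b j with j <? k
  ... | yes _ = a j
  ... | no  _ = m

  b-head : ∀ j → j < k → b j ≡ a j
  b-head j j<k with j <? k
  ... | yes _   = refl
  ... | no  j≮k = ⊥-elim (j≮k j<k)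

  b-block : ∀ j → k ≤ j → b j ≡ m
  b-block j k≤j with j <? k
  ... | yes j<k = ⊥-elim (<⇒≱ j<k k≤j)
  ... | no  _   = refl

  #Ω≡#Ω-b : ∀ L (c : ℕ → ℕ) → (∀ j → j < k → c j ≡ a j) → (∀ j → k ≤ j → j < L → M′ + suc j ≤ c j + L) →
            #Ω q L M′ c ≡ #Ω q L M′ b
  #Ω≡#Ω-b L c head block = #Ω-cong q L M′ c b agree
    where
    agree : ∀ j → j < L → SameCondition q M′ L j (c j) (b j)
    agree j j<L with k ≤? j
    ... | no  k≰j = inj₁ (trans (head j (≰⇒> k≰j)) (sym (b-head j (≰⇒> k≰j))))
    ... | yes k≤j = inj₂ (block j k≤j j<L , ≤-trans (+-mono-≤ (n≤1+n M′) j<L) (≤-reflexive (cong (_+ L) (sym (b-block j k≤j)))))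

  h : ℕ → ℕ
  h N = #Ω q k (N + k) a

  #Ω-b≡Free : ∀ t N → N + (t + k) ≤ m → #Ω q (t + k) (N + (t + k)) b ≡ Free q h t N
  #Ω-b≡Free t N N+t+k≤m = trans (#Ω-Free q k t N b (λ j k≤j _ → ≤-trans N+t+k≤m (≤-reflexive (sym (b-block j k≤j)))))
    (Free-cong q (λ N′ → #Ω-cong q k (N′ + k) b a (λ j j<k → inj₁ (b-head j j<k))) t N)

  #Ω[ℓ]-a′≡Free : #Ω q ℓ M′ a′ ≡ Free q h (suc s) (g′ + d)
  #Ω[ℓ]-a′≡Free = trans (#Ω≡#Ω-b ℓ a′ a′-head block) (#Ω-b≡Free (suc s) (g′ + d) (n≤1+n M′))
    where
    block : ∀ j → k ≤ j → j < ℓ → M′ + suc j ≤ a′ j + ℓ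
    block j k≤j j<ℓ = ≤-reflexive (sym (suc-injective (trans (cong (_+ ℓ) (a′-block j k≤j j<ℓ)) (a-block′ j k≤j j<ℓ))))

  #Ω[ℓ]-a≡Free : #Ω q ℓ M′ a ≡ Free q h (suc s) (g′ + d)
  #Ω[ℓ]-a≡Free = trans (#Ω≡#Ω-b ℓ a (λ _ _ → refl) block) (#Ω-b≡Free (suc s) (g′ + d) (n≤1+n M′))
    where
    block : ∀ j → k ≤ j → j < ℓ → M′ + suc j ≤ a j + ℓ
    block j k≤j j<ℓ = ≤-trans (n≤1+n _) (≤-reflexive (sym (a-block′ j k≤j j<ℓ)))

  #Ω[ℓ-1]-a≡Free : #Ω q (s + k) M′ a ≡ Free q h s (suc (g′ + d))
  #Ω[ℓ-1]-a≡Free = trans (#Ω≡#Ω-b (s + k) a (λ _ _ → refl) block)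
    (trans (cong (λ n → #Ω q (s + k) n b) M′≡) (#Ω-b≡Free s (suc (g′ + d)) (≤-trans (≤-reflexive (sym M′≡)) (n≤1+n M′))))
    where
    M′≡ = +-suc (g′ + d) (s + k)
    block : ∀ j → k ≤ j → j < s + k → M′ + suc j ≤ a j + (s + k)
    block j k≤j j<s+k = ≤-reflexive (sym (suc-injective (trans (sym (+-suc (a j) (s + k))) (a-block′ j k≤j (m<n⇒m<1+n j<s+k)))))

  -- h is constant, equal to A, from N = d on
  A : ℕ
  A = h d

  ε : ℕ → ℕ
  ε N with d ≤? N
  ... | yes _ = 0
  ... | no  _ = h N

  h-split : ∀ N → h N ≡ A * atLeast q d N + ε N
  h-split N with d ≤? N
  ... | no  _   = sym (cong (_+ h N) (*-zeroʳ A))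
  ... | yes d≤N = begin
    #Ω q k (N + k) a                  ≡⟨ cong (λ x → #Ω q k x a) N+k≡ ⟩
    #Ω q k (a k′ + (N ∸ d)) a         ≡⟨ #Ω-stable q k′ a (N ∸ d) ⟩
    #Ω q k (a k′) a                   ≡⟨ cong (λ x → #Ω q k x a) a-gap ⟩
    A                                 ≡⟨ sym (trans (+-identityʳ _) (*-identityʳ A)) ⟩
    A * 1 + 0                         ∎
    where
    open ≡.≡-Reasoning
    N+k≡ : N + k ≡ a k′ + (N ∸ d)
    N+k≡ = trans (cong (_+ k) (sym (m+[n∸m]≡n d≤N)))
                 (trans (solve 3 (λ d x k → d :+ x :+ k := d :+ k :+ x) refl d (N ∸ d) k) (cong (_+ (N ∸ d)) (sym a-gap)))

  X₂ X₃ Y₂ Y₃ : ℕ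
  X₂ = Free q (atLeast q d) (suc s) (g′ + d)
  X₃ = Free q (atLeast q d) s (suc (g′ + d))
  Y₂ = Free q ε (suc s) (g′ + d)
  Y₃ = Free q ε s (suc (g′ + d))

  #Ω[ℓ]-a-split : #Ω q ℓ M′ a ≡ A * X₂ + Y₂
  #Ω[ℓ]-a-split = trans #Ω[ℓ]-a≡Free (Free-linear q h (atLeast q d) ε A h-split (suc s) (g′ + d))

  #Ω[ℓ]-a′-split : #Ω q ℓ M′ a′ ≡ A * X₂ + Y₂
  #Ω[ℓ]-a′-split = trans #Ω[ℓ]-a′≡Free (Free-linear q h (atLeast q d) ε A h-split (suc s) (g′ + d))

  #Ω[ℓ-1]-a-split : #Ω q (s + k) M′ a ≡ A * X₃ + Y₃
  #Ω[ℓ-1]-a-split = trans #Ω[ℓ-1]-a≡Free (Free-linear q h (atLeast q d) ε A h-split s (suc (g′ + d)))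

  -- the q-Pascal identity [g + s + 1, s + 1] = q^(s+1) [g + s, s + 1] + [g + s, s]
  main-terms : q ^ g * q ^ u * X₃ + q ^ g * X₂ ≡ q ^ g * q ^ suc s * X₂ + q ^ u * X₃
  main-terms = begin
    q ^ g * q ^ u * X₃ + q ^ g * X₂
      ≡⟨ cong₂ (λ x y → q ^ g * q ^ u * x + q ^ g * y) X₃≡ X₂≡ ⟩
    q ^ g * q ^ u * (Ds * b₃) + q ^ g * (q ^ (suc s * d) * b₂)
      ≡⟨ cong₂ (λ x y → q ^ g * x * (Ds * b₃) + q ^ g * (y * b₂)) (^-distribˡ-+-* q g d) (^-distribˡ-+-* q d (s * d)) ⟩
    G * (G * Qd) * (Ds * b₃) + G * (Qd * Ds * b₂)
      ≡⟨ solve 5 (λ G Qd Ds b₂ b₃ → G :* (G :* Qd) :* (Ds :* b₃) :+ G :* (Qd :* Ds :* b₂) := G :* Qd :* Ds :* (b₂ :+ G :* b₃)) refl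
               G Qd Ds b₂ b₃ ⟩
    G * Qd * Ds * (b₂ + G * b₃)
      ≡⟨ cong (G * Qd * Ds *_) (binom-pascal q s g′) ⟩
    G * Qd * Ds * (T * b₂ + b₃)
      ≡⟨ solve 6 (λ G Qd Ds b₂ b₃ T → G :* Qd :* Ds :* (T :* b₂ :+ b₃) := G :* T :* (Qd :* Ds :* b₂) :+ (G :* Qd) :* (Ds :* b₃)) refl
               G Qd Ds b₂ b₃ T ⟩
    G * T * (Qd * Ds * b₂) + (G * Qd) * (Ds * b₃)
      ≡⟨ sym (cong₂ (λ x y → G * T * (x * b₂) + y * (Ds * b₃)) (^-distribˡ-+-* q d (s * d)) (^-distribˡ-+-* q g d)) ⟩
    q ^ g * q ^ suc s * (q ^ (suc s * d) * b₂) + q ^ u * (q ^ (s * d) * b₃)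
      ≡⟨ sym (cong₂ (λ x y → q ^ g * q ^ suc s * y + q ^ u * x) X₃≡ X₂≡) ⟩
    q ^ g * q ^ suc s * X₂ + q ^ u * X₃ ∎
    where
    open ≡.≡-Reasoning
    b₂ = binom q (suc s) g′
    b₃ = binom q s (suc g′)
    G  = q ^ g
    Qd = q ^ d
    Ds = q ^ (s * d)
    T  = q ^ suc s
    X₂≡ : X₂ ≡ q ^ (suc s * d) * b₂
    X₂≡ = trans (cong (Free q (atLeast q d) (suc s)) (+-comm g′ d)) (Free-atLeast q d (suc s) g′)
    X₃≡ : X₃ ≡ q ^ (s * d) * b₃
    X₃≡ = trans (cong (Free q (atLeast q d) s) (trans (cong suc (+-comm g′ d)) (sym (+-suc d g′)))) (Free-atLeast q d s (suc g′))

  δ̌ : ℕ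
  δ̌ = δ̂ a k′

  δ̂-head : δ̂ a k ≡ δ̌ + d
  δ̂-head = cong (δ̌ +_) (trans (cong (_∸ k) a-gap) (m+n∸n≡m d k))

  δ̂-a : δ̂ a ℓ ≡ δ̌ + d + suc s * u
  δ̂-a = trans (δ̂-block a k u (suc s) (λ j k≤j j<ℓ → trans (cong (_∸ suc j) (a-block j k≤j j<ℓ)) (m+n∸n≡m u (suc j))))
              (cong (_+ suc s * u) δ̂-head)

  δ̂-a′ : δ̂ a′ ℓ ≡ δ̌ + d + suc s * (g′ + d)
  δ̂-a′ = trans (δ̂-block a′ k (g′ + d) (suc s) (λ j k≤j j<ℓ → trans (cong (_∸ suc j) (a′-block′ j k≤j j<ℓ)) (m+n∸n≡m (g′ + d) (suc j))))
               (cong (_+ suc s * (g′ + d)) (trans (δ̂-cong k a′-head) δ̂-head))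
    where
    a′-block′ : ∀ j → k ≤ j → j < ℓ → a′ j ≡ g′ + d + suc j
    a′-block′ j k≤j j<ℓ = suc-injective (trans (a′-block j k≤j j<ℓ) (a-block j k≤j j<ℓ))

  δ̂-a≡ : δ̂ a ℓ ≡ δ̂ a′ ℓ + suc s
  δ̂-a≡ = begin
    δ̂ a ℓ                                   ≡⟨ δ̂-a ⟩
    δ̌ + d + suc s * (suc g′ + d)            ≡⟨ solve 4 (λ x s g′ d → x :+ (con 1 :+ s) :* (con 1 :+ g′ :+ d)
                                                              := (x :+ (con 1 :+ s) :* (g′ :+ d)) :+ (con 1 :+ s)) refl (δ̌ + d) s g′ d ⟩
    δ̌ + d + suc s * (g′ + d) + suc s        ≡⟨ cong (_+ suc s) (sym δ̂-a′) ⟩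
    δ̂ a′ ℓ + suc s                          ∎
    where open ≡.≡-Reasoning

  X K B : ℕ
  X = q ^ (k + δ̌)
  K = p ^ k * (p * (p + 2))
  B = X * (q * q) ^ d

  ε-small : ∀ j → j < d → p ^ k * ε j ≤ X * q ^ j
  ε-small j j<d with d ≤? j
  ... | yes d≤j = ⊥-elim (<⇒≱ j<d d≤j)
  ... | no  _   = ≤-trans (m+n≤o⇒m≤o _ (#Ω-bound-step k′ a (q ^ (k′ + δ̌)) (#Ω-bound k′ a a-head) (j + k) j+k≤ak′)) (≤-reflexive bound≡)
    where
    j+k≤ak′ : j + k ≤ a k′
    j+k≤ak′ = ≤-trans (+-monoˡ-≤ k (<⇒≤ j<d)) (≤-reflexive (sym a-gap))
    bound≡ : q ^ (k′ + δ̌) * q ^ (j + k ∸ k′) ≡ X * q ^ j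
    bound≡ = trans (cong (λ e → q ^ (k′ + δ̌) * q ^ e) (x+[1+y]∸y j k′))
                   (solve 3 (λ q x y → x :* (q :* y) := (q :* x) :* y) refl q (q ^ (k′ + δ̌)) (q ^ j))

  ε-vanish : ∀ j → d ≤ j → ε j ≡ 0
  ε-vanish j d≤j with d ≤? j
  ... | yes _   = refl
  ... | no  d≰j = ⊥-elim (d≰j d≤j)

  exponents : q ^ g * (B * q ^ s * (q ^ (g′ + d)) ^ s) ≡ q ^ ℓ * q ^ δ̂ a′ ℓ
  exponents = begin
    q ^ g * (q ^ (k + δ̌) * (q * q) ^ d * q ^ s * (q ^ (g′ + d)) ^ s)
      ≡⟨ cong₂ (λ x y → q ^ g * (q ^ (k + δ̌) * x * q ^ s * y))
               (trans (^-distribʳ-* q q d) (sym (^-distribˡ-+-* q d d))) (^-*-assoc q (g′ + d) s) ⟩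
    q ^ g * (q ^ (k + δ̌) * q ^ (d + d) * q ^ s * q ^ ((g′ + d) * s))
      ≡⟨ sym (cong (λ x → q ^ g * (x * q ^ ((g′ + d) * s)))
                   (trans (^-distribˡ-+-* q (k + δ̌ + (d + d)) s) (cong (_* q ^ s) (^-distribˡ-+-* q (k + δ̌) (d + d))))) ⟩
    q ^ g * (q ^ (k + δ̌ + (d + d) + s) * q ^ ((g′ + d) * s))
      ≡⟨ sym (trans (^-distribˡ-+-* q g _) (cong (q ^ g *_) (^-distribˡ-+-* q (k + δ̌ + (d + d) + s) ((g′ + d) * s)))) ⟩
    q ^ (g + (k + δ̌ + (d + d) + s + (g′ + d) * s))
      ≡⟨ cong (q ^_) (solve 5 (λ g′ k′ δ d s → (con 1 :+ g′) :+ ((con 1 :+ k′) :+ δ :+ (d :+ d) :+ s :+ (g′ :+ d) :* s)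
                                              := (con 1 :+ s :+ (con 1 :+ k′)) :+ (δ :+ d :+ (con 1 :+ s) :* (g′ :+ d))) refl g′ k′ δ̌ d s) ⟩
    q ^ (ℓ + (δ̌ + d + suc s * (g′ + d)))
      ≡⟨ trans (^-distribˡ-+-* q ℓ _) (cong (λ e → q ^ ℓ * q ^ e) (sym δ̂-a′)) ⟩
    q ^ ℓ * q ^ δ̂ a′ ℓ ∎
    where open ≡.≡-Reasoning

  error-term : q ^ g * Y₂ < q ^ δ̂ a′ ℓ
  error-term = *-cancelˡ-< (K * p ^ s) (q ^ g * Y₂) (q ^ δ̂ a′ ℓ) (begin-strict
    K * p ^ s * (q ^ g * Y₂)
      ≡⟨ solve 3 (λ x G y → x :* (G :* y) := G :* (x :* y)) refl (K * p ^ s) (q ^ g) Y₂ ⟩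
    q ^ g * (K * p ^ s * Y₂)
      ≤⟨ *-monoʳ-≤ (q ^ g) (Free-bound ε K B (Free-one-bound ε d (p ^ k) X ε-small ε-vanish) s (g′ + d)) ⟩
    q ^ g * (B * q ^ s * (q ^ (g′ + d)) ^ s)
      ≡⟨ exponents ⟩
    q * q ^ (s + k) * q ^ δ̂ a′ ℓ
      <⟨ *-monoˡ-< (q ^ δ̂ a′ ℓ) {{m^n≢0 q (δ̂ a′ ℓ)}} q-large ⟩
    p ^ (s + k) * (p * (p + 2)) * q ^ δ̂ a′ ℓ
      ≡⟨ cong (_* q ^ δ̂ a′ ℓ) K*p^s≡ ⟩
    K * p ^ s * q ^ δ̂ a′ ℓ ∎)
    where
    open ≤-Reasoning
    K*p^s≡ : p ^ (s + k) * (p * (p + 2)) ≡ K * p ^ s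
    K*p^s≡ = trans (cong (_* (p * (p + 2))) (^-distribˡ-+-* p s k))
                   (solve 3 (λ x y z → z :* x :* y := x :* y :* z) refl (p ^ k) (p * (p + 2)) (p ^ s))

  q^[1+s]≥2 : 2 ≤ q ^ suc s
  q^[1+s]≥2 = ≤-trans (s≤s (p≥1 p (s + k) (≤-trans (s≤s z≤n) q-large))) (m≤m*n q (q ^ s) {{m^n≢0 q s}})
    where
    p≥1 : ∀ x e → 0 < x ^ e * (x * (x + 2)) → 1 ≤ x
    p≥1 zero    e pos = ⊥-elim (<-irrefl refl (≤-trans pos (≤-reflexive (*-zeroʳ (0 ^ e)))))
    p≥1 (suc x) e _   = s≤s z≤n

  inequality : q ^ g * q ^ suc s * #Ω q ℓ (m ∸ 1) a′ + q ^ δ̂ a′ ℓ + q ^ u * #Ω q (s + k) (m ∸ 1) a < q ^ g * #Ω q ℓ m a + q ^ δ̂ a ℓ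
  inequality = begin-strict
    q ^ g * q ^ suc s * #Ω q ℓ M′ a′ + q ^ δ̂ a′ ℓ + q ^ u * #Ω q (s + k) M′ a
      ≡⟨ cong₂ (λ x y → q ^ g * q ^ suc s * x + q ^ δ̂ a′ ℓ + q ^ u * y) #Ω[ℓ]-a′-split #Ω[ℓ-1]-a-split ⟩
    q ^ g * q ^ suc s * (A * X₂ + Y₂) + q ^ δ̂ a′ ℓ + q ^ u * (A * X₃ + Y₃)
      <⟨ cancellation A X₂ X₃ Y₂ Y₃ (q ^ g) (q ^ suc s) (q ^ u) (q ^ δ̂ a′ ℓ) main-terms error-term q^[1+s]≥2 (m^n>0 q g) ⟩
    q ^ g * ((A * X₂ + Y₂) + (A * X₃ + Y₃) * q ^ u) + q ^ δ̂ a′ ℓ * q ^ suc s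
      ≡⟨ sym (cong₂ (λ x y → q ^ g * x + y) (trans #Ω-peel (cong₂ (λ x y → x + y * q ^ u) #Ω[ℓ]-a-split #Ω[ℓ-1]-a-split))
                                            (trans (cong (q ^_) δ̂-a≡) (^-distribˡ-+-* q (δ̂ a′ ℓ) (suc s)))) ⟩
    q ^ g * #Ω q ℓ m a + q ^ δ̂ a ℓ ∎
    where open ≤-Reasoning

-- Index sequences α : Fin ℓ → ℕ

!-toℕ : ∀ {ℓ} (α : Fin ℓ → ℕ) i → α ! suc (toℕ i) ≡ α i
!-toℕ {suc ℓ} α Fin.zero    = refl
!-toℕ {suc ℓ} α (Fin.suc i) = !-toℕ (λ j → α (Fin.suc j)) i

!-fromℕ< : ∀ {ℓ} (α : Fin ℓ → ℕ) j (j<ℓ : j < ℓ) → α ! suc j ≡ α (fromℕ< j<ℓ)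
!-fromℕ< α j j<ℓ = trans (cong (λ x → α ! suc x) (sym (toℕ-fromℕ< j<ℓ))) (!-toℕ α (fromℕ< j<ℓ))

αprime-head : ∀ {ℓ} k (α : Fin ℓ → ℕ) i → suc (toℕ i) ≤ k → αprime k α i ≡ α i
αprime-head k α i i<k with suc (toℕ i) ≤? k
... | yes _   = refl
... | no  i≮k = ⊥-elim (i≮k i<k)

αprime-block : ∀ {ℓ} k (α : Fin ℓ → ℕ) i → k ≤ toℕ i → αprime k α i ≡ α i ∸ 1
αprime-block k α i k≤i with suc (toℕ i) ≤? k
... | yes i<k = ⊥-elim (<⇒≱ i<k k≤i)
... | no  _   = refl

Σ< : (ℕ → ℕ) → ℕ → ℕ
Σ< b zero    = 0
Σ< b (suc L) = Σ< b L + b L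

Σ<-cons : ∀ b L → Σ< b (suc L) ≡ b 0 + Σ< (λ j → b (suc j)) L
Σ<-cons b zero    = sym (+-identityʳ (b 0))
Σ<-cons b (suc L) = trans (cong (_+ b (suc L)) (Σ<-cons b L)) (+-assoc (b 0) _ _)

sumF≡Σ< : ∀ {ℓ} (β : Fin ℓ → ℕ) → sumF β ≡ Σ< (λ j → β ! suc j) ℓ
sumF≡Σ< {zero}  β = refl
sumF≡Σ< {suc ℓ} β = trans (cong (β Fin.zero +_) (sumF≡Σ< (λ j → β (Fin.suc j)))) (sym (Σ<-cons (λ j → β ! suc j) ℓ))

Σ<≡tri+δ̂ : ∀ b L → (∀ j → j < L → suc j ≤ b j) → Σ< b L ≡ tri L + δ̂ b L
Σ<≡tri+δ̂ b zero    _  = refl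
Σ<≡tri+δ̂ b (suc L) b≥ = begin
  Σ< b L + b L
    ≡⟨ cong₂ _+_ (Σ<≡tri+δ̂ b L (λ j j<L → b≥ j (m<n⇒m<1+n j<L))) (sym (m+[n∸m]≡n (b≥ L (n<1+n L)))) ⟩
  tri L + δ̂ b L + (suc L + (b L ∸ suc L))
    ≡⟨ solve 4 (λ t D L x → t :+ D :+ ((con 1 :+ L) :+ x) := (con 1 :+ L :+ t) :+ (D :+ x)) refl (tri L) (δ̂ b L) L (b L ∸ suc L) ⟩
  tri (suc L) + δ̂ b (suc L) ∎
  where open ≡.≡-Reasoning

δ≡δ̂ : ∀ {ℓ} (β : Fin ℓ → ℕ) → (∀ j → j < ℓ → suc j ≤ β ! suc j) → δ β ≡ δ̂ (λ j → β ! suc j) ℓ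
δ≡δ̂ {ℓ} β β≥ = trans (cong (_∸ tri ℓ) (trans (sumF≡Σ< β) (Σ<≡tri+δ̂ _ ℓ β≥))) (m+n∸m≡n (tri ℓ) _)

|Ω|≡#Ω : ∀ {q} (F : FiniteField q) {ℓ n N} (α : Fin ℓ → ℕ) → HasCard (LinearAlgebra.Schubert F ℓ n α) N →
         N ≡ #Ω q ℓ n (λ j → α ! suc j)
|Ω|≡#Ω F α card = hasCard-unique card (EchelonForm.schubert-hasCard F (λ j → α ! suc j) α (!-toℕ α))

module FromMaxGap (p L m : ℕ) (α : Fin (suc L) → ℕ) (α∈I : InI (suc L) m α) (α-last : α ! suc L ≡ m)
                   (k′ : ℕ) (maxGap : IsMaxGap α (suc k′)) (q-large : suc p * suc p ^ L < p ^ L * (p * (p + 2))) where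

  q k ℓ : ℕ
  q = suc p
  k = suc k′
  ℓ = suc L

  a a′ ǎ : ℕ → ℕ
  a  j = α ! suc j
  a′ j = αprime k α ! suc j
  ǎ  j = αcheck α ! suc j

  a-increasing : ∀ j → suc j < ℓ → a j < a (suc j)
  a-increasing j j+1<ℓ = subst₂ _<_ (sym (!-fromℕ< α j j<ℓ)) (sym (!-fromℕ< α (suc j) j+1<ℓ))
    (proj₂ (proj₂ α∈I) (fromℕ< j<ℓ) (fromℕ< j+1<ℓ) (subst₂ _<_ (sym (toℕ-fromℕ< j<ℓ)) (sym (toℕ-fromℕ< j+1<ℓ)) (n<1+n j)))
    where j<ℓ = <-trans (n<1+n j) j+1<ℓ

  a≥ : ∀ j → j < ℓ → suc j ≤ a j
  a≥ zero    j<ℓ = subst (1 ≤_) (sym (!-fromℕ< α zero j<ℓ)) (proj₁ α∈I (fromℕ< j<ℓ))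
  a≥ (suc j) j<ℓ = ≤-trans (s≤s (a≥ j (<-trans (n<1+n j) j<ℓ))) (a-increasing j j<ℓ)

  k≤L : k ≤ L
  k≤L = proj₁ (proj₂ maxGap)

  no-gap : ∀ j → k ≤ j → suc j ≤ L → a (suc j) ≡ suc (a j)
  no-gap j k≤j j<L = ≤-antisym (≤-pred (≰⇒> (proj₂ (proj₂ (proj₂ maxGap)) (suc j) (s≤s k≤j) j<L))) (a-increasing j (s≤s j<L))

  s d g′ u : ℕ
  s  = L ∸ k
  d  = a k′ ∸ k
  g′ = a k ∸ (2 + a k′)
  u  = suc g′ + d

  s+k≡L : s + k ≡ L
  s+k≡L = m∸n+n≡m k≤L

  a-gap : a k′ ≡ d + k
  a-gap = sym (m∸n+n≡m (a≥ k′ (s≤s (≤-trans (n≤1+n k′) k≤L))))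

  a-k≡ : a k ≡ g′ + (2 + a k′)
  a-k≡ = sym (m∸n+n≡m (proj₁ (proj₂ (proj₂ maxGap))))

  a-consecutive : ∀ i → i + k < ℓ → a (i + k) ≡ a k + i
  a-consecutive zero    _     = sym (+-identityʳ (a k))
  a-consecutive (suc i) i+k<ℓ = trans (no-gap (i + k) (m≤n+m k i) (≤-pred i+k<ℓ))
    (trans (cong suc (a-consecutive i (<-trans (n<1+n _) i+k<ℓ))) (sym (+-suc (a k) i)))

  a-k+s≡m : a k + s ≡ m
  a-k+s≡m = trans (sym (a-consecutive s (subst (_< ℓ) (sym s+k≡L) (n<1+n L)))) (trans (cong a s+k≡L) α-last)

  m≡ : m ≡ u + (suc s + k)
  m≡ = trans (sym a-k+s≡m) (trans (cong (_+ s) (trans a-k≡ (cong (λ x → g′ + (2 + x)) a-gap)))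
             (solve 4 (λ g′ d k s → g′ :+ (con 2 :+ (d :+ k)) :+ s := (con 1 :+ g′ :+ d) :+ (con 1 :+ s :+ k)) refl g′ d k s))

  a-head : ∀ j → j < k′ → suc j ≤ a j
  a-head j j<k′ = a≥ j (<-trans j<k′ (s≤s (≤-trans (n≤1+n k′) k≤L)))

  a-block : ∀ j → k ≤ j → j < suc s + k → a j ≡ u + suc j
  a-block j k≤j j<ℓ = begin
    a j                      ≡⟨ cong a (sym j∸k+k≡j) ⟩
    a (j ∸ k + k)            ≡⟨ a-consecutive (j ∸ k) (subst (_< ℓ) (sym j∸k+k≡j) (subst (j <_) (cong suc s+k≡L) j<ℓ)) ⟩
    a k + (j ∸ k)            ≡⟨ +-cancelʳ-≡ (suc s + k) _ _ (begin
      a k + (j ∸ k) + (suc s + k)      ≡⟨ solve 4 (λ A i s k → (A :+ i) :+ (con 1 :+ s :+ k) := (A :+ s) :+ (con 1 :+ (i :+ k))) refl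
                                                  (a k) (j ∸ k) s k ⟩
      a k + s + suc (j ∸ k + k)        ≡⟨ cong₂ (λ x y → x + suc y) (trans a-k+s≡m m≡) j∸k+k≡j ⟩
      u + (suc s + k) + suc j          ≡⟨ solve 3 (λ u l j → (u :+ l) :+ j := (u :+ j) :+ l) refl u (suc s + k) (suc j) ⟩
      u + suc j + (suc s + k)          ∎) ⟩
    u + suc j                ∎
    where
    open ≡.≡-Reasoning
    j∸k+k≡j = m∸n+n≡m k≤j

  a′-head : ∀ j → j < k → a′ j ≡ a j
  a′-head j j<k = trans (!-fromℕ< (αprime k α) j j<ℓ)
    (trans (αprime-head k α (fromℕ< j<ℓ) (subst (λ x → suc x ≤ k) (sym (toℕ-fromℕ< j<ℓ)) j<k)) (sym (!-fromℕ< α j j<ℓ)))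
    where j<ℓ = <-trans j<k (s≤s k≤L)

  a′-block : ∀ j → k ≤ j → j < suc s + k → suc (a′ j) ≡ a j
  a′-block j k≤j j<s+k = begin
    suc (αprime k α ! suc j)                ≡⟨ cong suc (!-fromℕ< (αprime k α) j j<ℓ) ⟩
    suc (αprime k α (fromℕ< j<ℓ))           ≡⟨ cong suc (αprime-block k α (fromℕ< j<ℓ) (subst (k ≤_) (sym (toℕ-fromℕ< j<ℓ)) k≤j)) ⟩
    suc (α (fromℕ< j<ℓ) ∸ 1)                ≡⟨ cong (λ x → suc (x ∸ 1)) (sym (!-fromℕ< α j j<ℓ)) ⟩
    suc (a j ∸ 1)                           ≡⟨ m+[n∸m]≡n (≤-trans (s≤s z≤n) (a≥ j j<ℓ)) ⟩
    a j                                     ∎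
    where
    open ≡.≡-Reasoning
    j<ℓ = subst (j <_) (cong suc s+k≡L) j<s+k

  a′≥ : ∀ j → j < ℓ → suc j ≤ a′ j
  a′≥ j j<ℓ with j <? k
  ... | yes j<k = subst (suc j ≤_) (sym (a′-head j j<k)) (a≥ j j<ℓ)
  ... | no  j≮k = ≤-pred (subst (suc (suc j) ≤_) (sym (a′-block j (≮⇒≥ j≮k) j<s+k))
                                (≤-trans (s≤s (m≤n+m (suc j) (g′ + d))) (≤-reflexive (sym (a-block j (≮⇒≥ j≮k) j<s+k)))))
    where j<s+k = subst (j <_) (sym (cong suc s+k≡L)) j<ℓ

  ǎ≗a : ∀ j → j < L → ǎ j ≡ a j
  ǎ≗a j j<L = trans (!-fromℕ< (αcheck α) j j<L)
    (trans (sym (!-toℕ α (inject≤ (fromℕ< j<L) (m∸n≤m ℓ 1))))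
           (cong (λ x → α ! suc x) (trans (toℕ-inject≤ (fromℕ< j<L) (m∸n≤m ℓ 1)) (toℕ-fromℕ< j<L))))

  G : ℕ
  G = (α ! suc k) ∸ (α ! k) ∸ 1

  G≡ : G ≡ suc g′
  G≡ = begin
    a k ∸ a k′ ∸ 1                    ≡⟨ cong (λ x → x ∸ a k′ ∸ 1) a-k≡ ⟩
    g′ + (2 + a k′) ∸ a k′ ∸ 1        ≡⟨ cong (λ x → x ∸ a k′ ∸ 1) (sym (+-assoc g′ 2 (a k′))) ⟩
    g′ + 2 + a k′ ∸ a k′ ∸ 1          ≡⟨ cong (_∸ 1) (m+n∸n≡m (g′ + 2) (a k′)) ⟩
    g′ + 2 ∸ 1                        ≡⟨ cong (_∸ 1) (+-comm g′ 2) ⟩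
    suc g′                            ∎
    where open ≡.≡-Reasoning

  m∸ℓ≡u : m ∸ ℓ ≡ u
  m∸ℓ≡u = trans (cong (_∸ ℓ) (trans m≡ (cong (λ x → u + suc x) s+k≡L))) (m+n∸n≡m u ℓ)

  module Block = BlockShape p k′ d g′ s a a′ a-head a-gap a-block a′-head a′-block
                            (subst (λ x → suc p * suc p ^ x < p ^ x * (p * (p + 2))) (sym s+k≡L) q-large)

  inequality : ∀ {N₁ N₂ N₃} → N₁ ≡ #Ω q ℓ m a → N₂ ≡ #Ω q ℓ (m ∸ 1) a′ → N₃ ≡ #Ω q L (m ∸ 1) ǎ →
               q ^ G * q ^ (ℓ ∸ k) * N₂ + q ^ δ (αprime k α) + q ^ (m ∸ ℓ) * N₃ < q ^ G * N₁ + q ^ δ α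
  inequality refl refl refl = begin-strict
    q ^ G * q ^ (ℓ ∸ k) * #Ω q ℓ (m ∸ 1) a′ + q ^ δ (αprime k α) + q ^ (m ∸ ℓ) * #Ω q L (m ∸ 1) ǎ
      ≡⟨ cong₂ _+_ (cong₂ _+_ (cong₂ (λ x y → q ^ x * q ^ y * #Ω q ℓ (m ∸ 1) a′) G≡ (∸-suc k≤L)) (cong (q ^_) (δ≡δ̂ (αprime k α) a′≥)))
                   (cong₂ (λ x y → q ^ x * y) m∸ℓ≡u (#Ω-cong q L (m ∸ 1) ǎ a (λ j j<L → inj₁ (ǎ≗a j j<L)))) ⟩
    q ^ suc g′ * q ^ suc s * #Ω q ℓ (m ∸ 1) a′ + q ^ δ̂ a′ ℓ + q ^ u * #Ω q L (m ∸ 1) a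
      <⟨ subst₂ Shape (cong suc s+k≡L) (sym m≡) Block.inequality ⟩
    q ^ suc g′ * #Ω q ℓ m a + q ^ δ̂ a ℓ
      ≡⟨ sym (cong₂ (λ x y → q ^ x * #Ω q ℓ m a + q ^ y) G≡ (δ≡δ̂ α a≥)) ⟩
    q ^ G * #Ω q ℓ m a + q ^ δ α ∎
    where
    open ≤-Reasoning
    Shape : ℕ → ℕ → Set
    Shape ℓ′ m′ = q ^ suc g′ * q ^ suc s * #Ω q ℓ′ (m′ ∸ 1) a′ + q ^ δ̂ a′ ℓ′ + q ^ u * #Ω q (ℓ′ ∸ 1) (m′ ∸ 1) a
                < q ^ suc g′ * #Ω q ℓ′ m′ a + q ^ δ̂ a ℓ′

-- (q - 1)^L / q^L > 1/2 forces q ≥ 3, and then 2q ≤ q² - 1 = p (p + 2)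
p≥2 : ∀ p L → suc p ^ suc L < 2 * p ^ suc L → 2 ≤ p
p≥2 zero          L ()
p≥2 (suc zero)    L hq = ⊥-elim (<⇒≱ (subst (λ x → 2 * 2 ^ L < 2 * (1 * x)) (^-zeroˡ L) hq) (*-monoʳ-≤ 2 (m^n>0 2 L)))
p≥2 (suc (suc p)) L _  = s≤s (s≤s z≤n)

q-large : ∀ p L → suc p ^ suc L < 2 * p ^ suc L → suc p * suc p ^ suc L < p ^ suc L * (p * (p + 2))
q-large p L hq = <-≤-trans (*-monoʳ-< (suc p) hq) (begin
  suc p * (2 * p ^ suc L)      ≡⟨ solve 2 (λ p x → (con 1 :+ p) :* (con 2 :* x) := x :* (con 2 :+ con 2 :* p)) refl p (p ^ suc L) ⟩
  p ^ suc L * (2 + 2 * p)      ≤⟨ *-monoʳ-≤ (p ^ suc L) (+-monoˡ-≤ (2 * p) (*-mono-≤ (≤-trans (n≤1+n 1) 2≤p) 2≤p)) ⟩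
  p ^ suc L * (p * p + 2 * p)  ≡⟨ cong (p ^ suc L *_) (solve 1 (λ p → p :* p :+ con 2 :* p := p :* (p :+ con 2)) refl p) ⟩
  p ^ suc L * (p * (p + 2))    ∎)
  where
  open ≤-Reasoning
  2≤p = p≥2 p L hq

open import Data.Nat using (ℕ; _≤_; _<_; _∸_; _^_; _*_; suc)
open import Data.Fin using (Fin)
open import Data.Integer as ℤ using (ℤ; +_)
open import Relation.Binary.PropositionalEquality using (_≡_)
import Data.Integer.Properties as ℤₚ
import Data.Integer.Solver as ℤSolver

pos-^ : ∀ q n → (+ q) ℤ.^ n ≡ + (q ^ n)
pos-^ q zero    = refl
pos-^ q (suc n) = trans (cong ((+ q) ℤ.*_) (pos-^ q n)) (sym (ℤₚ.pos-* q (q ^ n)))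

ℕ<⇒ℤ< : ∀ q G T U D′ D N₁ N₂ N₃ → q ^ G * q ^ T * N₂ + q ^ D′ + q ^ U * N₃ < q ^ G * N₁ + q ^ D →
        (+ q) ℤ.^ D′ ℤ.+ (+ q) ℤ.^ U ℤ.* + N₃ ℤ.- (+ q) ℤ.^ D ℤ.< (+ q) ℤ.^ G ℤ.* (+ N₁ ℤ.- (+ q) ℤ.^ T ℤ.* + N₂)
ℕ<⇒ℤ< q G T U D′ D N₁ N₂ N₃ h
  rewrite pos-^ q G | pos-^ q T | pos-^ q U | pos-^ q D′ | pos-^ q D = shift (q ^ G) (q ^ T) (q ^ U) (q ^ D) (q ^ D′) N₁ N₂ N₃ h
  where
  -- subtract e + g t n₂ from both sides
  shift : ∀ g t u e e′ n₁ n₂ n₃ → g * t * n₂ + e′ + u * n₃ < g * n₁ + e →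
          + e′ ℤ.+ + u ℤ.* + n₃ ℤ.- + e ℤ.< + g ℤ.* (+ n₁ ℤ.- + t ℤ.* + n₂)
  shift g t u e e′ n₁ n₂ n₃ h = subst₂ ℤ._<_ (sym lhs≡) (sym rhs≡) (ℤₚ.+-monoˡ-< (ℤ.- Z) (ℤ.+<+ h))
    where
    open ℤSolver.+-*-Solver using () renaming (solve to solveℤ; _:+_ to _⊕_; _:*_ to _⊛_; _:-_ to _⊖_; _:=_ to _≐_)
    Z : ℤ
    Z = + e ℤ.+ + g ℤ.* + t ℤ.* + n₂
    lhs≡ : + e′ ℤ.+ + u ℤ.* + n₃ ℤ.- + e ≡ + (g * t * n₂ + e′ + u * n₃) ℤ.+ ℤ.- Z
    lhs≡ = begin
      + e′ ℤ.+ + u ℤ.* + n₃ ℤ.- + e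
        ≡⟨ solveℤ 7 (λ g t u e e′ n₂ n₃ → e′ ⊕ u ⊛ n₃ ⊖ e ≐ (g ⊛ t ⊛ n₂ ⊕ e′ ⊕ u ⊛ n₃) ⊖ (e ⊕ g ⊛ t ⊛ n₂)) refl
                  (+ g) (+ t) (+ u) (+ e) (+ e′) (+ n₂) (+ n₃) ⟩
      + g ℤ.* + t ℤ.* + n₂ ℤ.+ + e′ ℤ.+ + u ℤ.* + n₃ ℤ.- Z
        ≡⟨ cong (ℤ._- Z) (sym (trans (ℤₚ.pos-+ _ (u * n₃)) (cong₂ ℤ._+_ (trans (ℤₚ.pos-+ (g * t * n₂) e′)
                            (cong (ℤ._+ + e′) (trans (ℤₚ.pos-* (g * t) n₂) (cong (ℤ._* + n₂) (ℤₚ.pos-* g t))))) (ℤₚ.pos-* u n₃)))) ⟩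
      + (g * t * n₂ + e′ + u * n₃) ℤ.- Z ∎
      where open ≡.≡-Reasoning
    rhs≡ : + g ℤ.* (+ n₁ ℤ.- + t ℤ.* + n₂) ≡ + (g * n₁ + e) ℤ.+ ℤ.- Z
    rhs≡ = begin
      + g ℤ.* (+ n₁ ℤ.- + t ℤ.* + n₂)
        ≡⟨ solveℤ 5 (λ g t e n₁ n₂ → g ⊛ (n₁ ⊖ t ⊛ n₂) ≐ (g ⊛ n₁ ⊕ e) ⊖ (e ⊕ g ⊛ t ⊛ n₂)) refl
                  (+ g) (+ t) (+ e) (+ n₁) (+ n₂) ⟩
      + g ℤ.* + n₁ ℤ.+ + e ℤ.- Z
        ≡⟨ cong (ℤ._- Z) (sym (trans (ℤₚ.pos-+ (g * n₁) e) (cong (ℤ._+ + e) (ℤₚ.pos-* g n₁)))) ⟩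
      + (g * n₁ + e) ℤ.- Z ∎
      where open ≡.≡-Reasoning

theorem3p14 : ∀ {q : ℕ} (F : FiniteField q) (ℓ m : ℕ) → 2 ≤ ℓ → ℓ ≤ m ∸ 1 →
    (α : Fin ℓ → ℕ) → InI ℓ m α → α ! ℓ ≡ m →
    (k : ℕ) → IsMaxGap α k →
    q ^ (ℓ ∸ 1) < 2 * (q ∸ 1) ^ (ℓ ∸ 1) →
    (N₁ N₂ N₃ : ℕ) →
    HasCard (LinearAlgebra.Schubert F ℓ m α) N₁ →
    HasCard (LinearAlgebra.Schubert F ℓ (m ∸ 1) (αprime k α)) N₂ →
    HasCard (LinearAlgebra.Schubert F (ℓ ∸ 1) (m ∸ 1) (αcheck α)) N₃ →
    (+ q) ℤ.^ ((α ! suc k) ∸ (α ! k) ∸ 1)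
        ℤ.* (+ N₁ ℤ.- (+ q) ℤ.^ (ℓ ∸ k) ℤ.* + N₂)
      ℤ.> (+ q) ℤ.^ δ (αprime k α) ℤ.+ (+ q) ℤ.^ (m ∸ ℓ) ℤ.* + N₃
            ℤ.- (+ q) ℤ.^ δ α
theorem3p14         F zero          _ ()        _ _ _ _ _ _        _ _ _ _ _ _ _
theorem3p14         F (suc zero)    _ (s≤s ()) _ _ _ _ _ _        _ _ _ _ _ _ _
theorem3p14 {zero}  F (suc (suc L)) _ _        _ _ _ _ _ _        () _ _ _ _ _ _
theorem3p14 {suc p} F (suc (suc L)) _ _        _ _ _ _ zero (() , _) _ _ _ _ _ _ _
theorem3p14 {suc p} F (suc (suc L)) m _ _ α α∈I α-last (suc k′) maxGap hq N₁ N₂ N₃ Ω₁ Ω₂ Ω₃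
  = ℕ<⇒ℤ< (suc p) G (ℓ ∸ suc k′) (m ∸ ℓ) (δ (αprime (suc k′) α)) (δ α) N₁ N₂ N₃
      (inequality (|Ω|≡#Ω F α Ω₁) (|Ω|≡#Ω F (αprime (suc k′) α) Ω₂) (|Ω|≡#Ω F (αcheck α) Ω₃))
  where open FromMaxGap p (suc L) m α α∈I α-last k′ maxGap (q-large p L hq) using (G; ℓ; inequality)
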